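{- Let $k\ge1$ and $1\le r\le (2k+1)^2$. The number of equivalence classes of $\mathcal{B}(2k+1,2k+1;r)$ under $D_4$ is \[\frac{1}{8}\left(\binom{(2k+1)^2}{r}+2\binom{k(k+1)}{r/4}+2\binom{k(k+1)}{(r-1)/4}+\binom{2k(k+1)}{\lfloor r/2\rfloor}+4\sum_{t=0}^{r}\binom{2k+1}{t}\binom{k(2k+1)}{(r-t)/2}\right).\]
   Context: $\mathcal{B}(2k+1,2k+1;r)$ is the set of all $(2k+1)\times(2k+1)$ grids with exactly $r$ blocked cells. $D_4$ acts on boards by the four rotations about the center and the reflections across the horizontal, vertical and two diagonal bisecting lines; two boards are equivalent if one is an image of the other. Convention: $\binom{a}{b}=0$ when $b$ is not a nonnegative integer or $b>a$. -}

module Defs where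

open import Data.Nat using (ℕ; zero; suc; _+_; _*_; _∸_; _/_; _%_; _≟_)
open import Data.Nat.Combinatorics using (_C_)
open import Data.Fin using (Fin; opposite)
open import Data.Product using (Σ; _×_; _,_; ∃)
open import Data.Bool using (Bool; true; false; if_then_else_)
open import Data.List using (List; map; upTo; allFin)
open import Data.Nat.ListAction using (sum)
open import Relation.Binary.PropositionalEquality using (_≡_)
open import Relation.Nullary.Decidable using (⌊_⌋)
open import Function.Bundles using (_⇔_)

-- A cell of an n × n grid: (row, column).
Cell : ℕ → Set
Cell n = Fin n × Fin n

-- A board: which cells are blocked (true = blocked).
Board : ℕ → Set
Board n = Cell n → Bool

blockedCount : ∀ {n} → Board n → ℕ
blockedCount {n} b =
  sum (map (λ i → sum (map (λ j → if b (i , j) then 1 else 0) (allFin n))) (allFin n))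

BoardR : ℕ → ℕ → Set
BoardR n r = Σ (Board n) (λ b → blockedCount b ≡ r)

data D4 : Set where
  id r90 r180 r270 flipH flipV flipD flipA : D4

act : ∀ {n} → D4 → Cell n → Cell n
act id    (i , j) = (i , j)
act r90   (i , j) = (j , opposite i)
act r180  (i , j) = (opposite i , opposite j)
act r270  (i , j) = (opposite j , i)
act flipH (i , j) = (opposite i , j)
act flipV (i , j) = (i , opposite j)
act flipD (i , j) = (j , i)
act flipA (i , j) = (opposite j , opposite i)

-- b' is equivalent to b iff b' = b ∘ act g pointwise for some g ∈ D4
-- (D4 is a group closed under inverses, so this is the orbit relation).
Equivalent : ∀ {n} → Board n → Board n → Set
Equivalent b b' = ∃ λ (g : D4) → ∀ c → b' c ≡ b (act g c)

-- A set X with an equivalence relation ~ has exactly N equivalence classes: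
-- there is a surjective class map into Fin N identifying exactly equivalent elements.
HasNClasses : ∀ {n} (r : ℕ) → ℕ → Set
HasNClasses {n} r N =
  Σ (BoardR n r → Fin N) λ cls →
    (∀ (i : Fin N) → ∃ λ x → cls x ≡ i) ×
    (∀ (x y : BoardR n r) → (cls x ≡ cls y) ⇔ Equivalent (Σ.proj₁ x) (Σ.proj₁ y))

-- binomial a (m/d) with convention: 0 unless d ∣ m (i.e. m/d is a nonneg. integer);
-- _C_ already gives 0 when the lower index exceeds the upper.
binomFrac : ℕ → ℕ → (d : ℕ) → .{{_ : Data.Nat.NonZero d}} → ℕ
binomFrac a m d = if ⌊ m % d ≟ 0 ⌋ then a C (m / d) else 0

-- 8 times the claimed number of classes
formula : ℕ → ℕ → ℕ
formula k r =
  ((2 * k + 1) * (2 * k + 1)) C r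
  + 2 * binomFrac (k * (k + 1)) r 4
  + 2 * binomFrac (k * (k + 1)) (r ∸ 1) 4
  + (2 * k * (k + 1)) C (r / 2)
  + 4 * sum (map (λ t → ((2 * k + 1) C t) * binomFrac (k * (2 * k + 1)) (r ∸ t) 2)
                 (upTo (suc r)))

{-# OPTIONS --safe #-}
-- Burnside's lemma: eight times the number of classes is the sum, over the eight symmetries g,
-- of the number of boards with r blocked cells fixed by g.  Centring the grid, the symmetries are
-- the signed permutations of the two coordinates.  A board fixed by g is a colouring of the orbits
-- of the cyclic group generated by g, so the number of such boards with r blocked cells is the
-- number of sub-multisets with sum r of the multiset of orbit sizes.  On a grid of side 2k+1 every
-- symmetry moves the cells off its fixed set in orbits of one common size: the identity fixes all
-- (2k+1)² cells; a quarter turn fixes only the centre and has k(k+1) orbits of size 4; the half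
-- turn fixes only the centre and has 2k(k+1) orbits of size 2; each of the four reflections fixes
-- 2k+1 cells and has k(2k+1) orbits of size 2.  Counting the sub-multisets gives the five terms.
module Submission where

open import Defs
open import Level using (0ℓ)
open import Algebra.Bundles using (Group)
open import Algebra.Core using (Op₁; Op₂)
open import Algebra.Structures using (IsGroup)
import Algebra.Properties.Group as GroupProperties
open import Data.Bool using (Bool; true; false; if_then_else_; _xor_)
import Data.Bool.Properties as Bool
open import Data.Bool.Properties using (xor-assoc; xor-same; xor-identityʳ)
open import Data.Empty using (⊥-elim)
open import Data.Fin as Fin using (Fin; opposite; toℕ; fromℕ<)
open import Data.Fin.Properties using (opposite-involutive; opposite-prop; toℕ-injective; toℕ-fromℕ<; toℕ<n)
open import Data.List
  using (List; []; _∷_; _++_; map; length; replicate; cartesianProduct; allFin; upTo; applyUpTo; lookup;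
         deduplicate)
open import Data.List.Properties using (length-tabulate; length-applyUpTo; ++-identityʳ)
open import Data.List.Membership.Propositional using (_∈_; _∉_; lose)
open import Data.List.Membership.Propositional.Properties
  using (∈-allFin; ∈-cartesianProduct⁺; ∈-lookup; ∈-applyUpTo⁺; ∈-applyUpTo⁻)
open import Data.List.Relation.Binary.Permutation.Propositional as ↭ using (_↭_; ↭-sym; ↭-trans)
open import Data.List.Relation.Binary.Permutation.Propositional.Properties using (shift)
open import Data.List.Relation.Unary.All as All using (All; []; _∷_; all?)
open import Data.List.Relation.Unary.AllPairs using ([]; _∷_)
open import Data.List.Relation.Unary.Any as Any using (Any; here; there; any?)
open import Data.List.Relation.Unary.Any.Properties using (lookup-index)
open import Data.List.Relation.Unary.Enumerates.Setoid.Properties using (deduplicate⁺)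
open import Data.List.Relation.Unary.Unique.Propositional using (Unique)
open import Data.List.Relation.Unary.Unique.Propositional.Properties
  using (allFin⁺; cartesianProduct⁺; applyUpTo⁺₁; Unique[x∷xs]⇒x∉xs)
open import Data.List.Relation.Unary.Unique.Setoid using () renaming (Unique to Unique≈)
open import Data.List.Relation.Unary.Unique.DecSetoid.Properties using (deduplicate-!)
open import Data.Nat
  using (ℕ; zero; suc; pred; _+_; _*_; _∸_; _/_; _%_; _<_; _≤_; z≤n; s≤s; z<s; NonZero)
  renaming (_≟_ to _≟ℕ_)
open import Data.Nat.Combinatorics using (_C_; nCk+nC[k+1]≡[n+1]C[k+1]; k>n⇒nCk≡0)
open import Data.Nat.DivMod
  using (m≡m%n+[m/n]*n; m%n<n; m*n%n≡0; m*n/n≡m; [m+kn]%n≡m%n; +-distrib-/-∣ʳ)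
open import Data.Nat.Divisibility using (divides)
open import Data.Nat.ListAction using (sum)
open import Data.Nat.Properties
  using (+-assoc; +-comm; +-identityʳ; +-cancelˡ-≡; +-cancelʳ-≡; +-monoʳ-<; +-commutativeSemigroup;
         *-comm; *-suc; *-zeroʳ; *-identityˡ; *-identityʳ; *-distribˡ-+; *-distribʳ-+; *-cancelˡ-≡;
         *-cancelʳ-≡; suc-pred; 1+n≢0; m∸n+n≡m; m<n⇒0<n∸m; <⇒≤; <-≤-trans; ≤-<-trans; m≤m+n; m<m+n)
open import Data.Nat.Tactic.RingSolver using (solve-∀)
open import Algebra.Properties.CommutativeSemigroup +-commutativeSemigroup
  using (interchange; x∙yz≈y∙xz; x∙yz≈xz∙y)
open import Data.Product using (Σ; _×_; _,_; proj₁; proj₂; ∃-syntax; uncurry)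
open import Data.Product.Properties using (≡-dec)
open import Data.Unit using (tt)
import Function.Endo.Propositional as Endo
open import Function using (_∘_; _⇔_; mk⇔; Equivalence)
open import Relation.Binary using (Rel; Setoid; DecSetoid; IsDecEquivalence; _Respects_)
import Relation.Binary.Construct.On as On
open import Relation.Binary.Definitions using (DecidableEquality)
open import Relation.Binary.PropositionalEquality
  using (_≡_; _≢_; refl; sym; trans; cong; cong₂; cong-app; subst; isEquivalence; module ≡-Reasoning)
import Relation.Binary.PropositionalEquality as ≡
open import Relation.Nullary using (Dec; yes; no; does; ¬_; ¬?; _×-dec_)
open import Relation.Nullary.Decidable using (map′)
open import Relation.Unary using (Pred; Decidable)

-- Sums and Iverson brackets

bit : Bool → ℕ
bit b = if b then 1 else 0

𝟙 : {P : Set} → Dec P → ℕ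
𝟙 p = bit (does p)

module _ {P : Set} where

  𝟙-yes : (p : Dec P) → P → 𝟙 p ≡ 1
  𝟙-yes (yes _) _ = refl
  𝟙-yes (no ¬p) p = ⊥-elim (¬p p)

  𝟙-no : (p : Dec P) → ¬ P → 𝟙 p ≡ 0
  𝟙-no (yes p) ¬p = ⊥-elim (¬p p)
  𝟙-no (no _)  _  = refl

module _ {P Q : Set} where

  𝟙-⇔ : (p : Dec P) (q : Dec Q) → P ⇔ Q → 𝟙 p ≡ 𝟙 q
  𝟙-⇔ p (yes q) P⇔Q = 𝟙-yes p (Equivalence.from P⇔Q q)
  𝟙-⇔ p (no ¬q) P⇔Q = 𝟙-no p (¬q ∘ Equivalence.to P⇔Q)

  𝟙-× : (p : Dec P) (q : Dec Q) → 𝟙 (p ×-dec q) ≡ 𝟙 p * 𝟙 q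
  𝟙-× (yes _) (yes _) = refl
  𝟙-× (yes _) (no _)  = refl
  𝟙-× (no _)  _       = refl

∑ : {A : Set} → List A → (A → ℕ) → ℕ
∑ xs f = sum (map f xs)

infix 6.5 ∑
syntax ∑ xs (λ x → e) = ∑[ x ∈ xs ] e

module _ {A : Set} where

  ∑-cong-∈ : ∀ (xs : List A) {f g : A → ℕ} → (∀ {x} → x ∈ xs → f x ≡ g x) → ∑ xs f ≡ ∑ xs g
  ∑-cong-∈ []       _   = refl
  ∑-cong-∈ (x ∷ xs) f≗g = cong₂ _+_ (f≗g (here refl)) (∑-cong-∈ xs (f≗g ∘ there))

  ∑-cong : ∀ (xs : List A) {f g : A → ℕ} → (∀ x → f x ≡ g x) → ∑ xs f ≡ ∑ xs g
  ∑-cong xs f≗g = ∑-cong-∈ xs (λ {x} _ → f≗g x)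

  ∑-zero : ∀ (xs : List A) {f : A → ℕ} → (∀ x → f x ≡ 0) → ∑ xs f ≡ 0
  ∑-zero []       _   = refl
  ∑-zero (x ∷ xs) f≡0 = cong₂ _+_ (f≡0 x) (∑-zero xs f≡0)

  ∑-const : ∀ (xs : List A) c → ∑[ x ∈ xs ] c ≡ length xs * c
  ∑-const []       c = refl
  ∑-const (x ∷ xs) c = cong (c +_) (∑-const xs c)

  ∑-+ : ∀ (xs : List A) (f g : A → ℕ) → ∑[ x ∈ xs ] (f x + g x) ≡ ∑ xs f + ∑ xs g
  ∑-+ []       f g = refl
  ∑-+ (x ∷ xs) f g = trans (cong (f x + g x +_) (∑-+ xs f g)) (interchange (f x) (g x) _ _)

  ∑-*ˡ : ∀ (xs : List A) c (f : A → ℕ) → ∑[ x ∈ xs ] c * f x ≡ c * ∑ xs f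
  ∑-*ˡ []       c f = sym (*-zeroʳ c)
  ∑-*ˡ (x ∷ xs) c f = trans (cong (c * f x +_) (∑-*ˡ xs c f)) (sym (*-distribˡ-+ c (f x) _))

  ∑-*ʳ : ∀ (xs : List A) c (f : A → ℕ) → ∑[ x ∈ xs ] f x * c ≡ ∑ xs f * c
  ∑-*ʳ xs c f = trans (∑-cong xs (λ x → *-comm (f x) c)) (trans (∑-*ˡ xs c f) (*-comm c _))

  ∑-++ : ∀ (xs ys : List A) (f : A → ℕ) → ∑ (xs ++ ys) f ≡ ∑ xs f + ∑ ys f
  ∑-++ []       ys f = refl
  ∑-++ (x ∷ xs) ys f = trans (cong (f x +_) (∑-++ xs ys f)) (sym (+-assoc (f x) _ _))

  ∑-𝟙⇒Any : ∀ {P : Pred A 0ℓ} (P? : Decidable P) xs → ∑[ x ∈ xs ] 𝟙 (P? x) ≢ 0 → Any P xs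
  ∑-𝟙⇒Any P? []       ∑≢0 = ⊥-elim (∑≢0 refl)
  ∑-𝟙⇒Any P? (x ∷ xs) ∑≢0 with P? x
  ... | yes px = here px
  ... | no _   = there (∑-𝟙⇒Any P? xs ∑≢0)

∑-map : ∀ {A B : Set} (g : A → B) xs (f : B → ℕ) → ∑ (map g xs) f ≡ ∑ xs (f ∘ g)
∑-map g []       f = refl
∑-map g (x ∷ xs) f = cong (f (g x) +_) (∑-map g xs f)

module _ {A B : Set} where

  ∑-swap : ∀ (xs : List A) (ys : List B) (f : A → B → ℕ) →
           ∑[ x ∈ xs ] ∑[ y ∈ ys ] f x y ≡ ∑[ y ∈ ys ] ∑[ x ∈ xs ] f x y
  ∑-swap []       ys f = sym (∑-zero ys (λ _ → refl))
  ∑-swap (x ∷ xs) ys f =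
    trans (cong (∑ ys (f x) +_) (∑-swap xs ys f)) (sym (∑-+ ys (f x) (λ y → ∑[ x ∈ xs ] f x y)))

  ∑-cartesianProduct : ∀ (xs : List A) (ys : List B) (f : A × B → ℕ) →
                       ∑ (cartesianProduct xs ys) f ≡ ∑[ x ∈ xs ] ∑[ y ∈ ys ] f (x , y)
  ∑-cartesianProduct []       ys f = refl
  ∑-cartesianProduct (x ∷ xs) ys f = trans (∑-++ (map (x ,_) ys) _ f)
    (cong₂ _+_ (∑-map (x ,_) ys f) (∑-cartesianProduct xs ys f))

∑-allFin-const : ∀ n c → ∑[ i ∈ allFin n ] c ≡ n * c
∑-allFin-const n c = trans (∑-const (allFin n) c) (cong (_* c) (length-tabulate {n = n} (λ i → i)))

∑-applyUpTo : ∀ (g : ℕ → ℕ) n (F : ℕ → ℕ) → ∑ (applyUpTo g n) F ≡ ∑[ t ∈ upTo n ] F (g t)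
∑-applyUpTo g zero    F = refl
∑-applyUpTo g (suc n) F =
  cong (F (g 0) +_) (trans (∑-applyUpTo (g ∘ suc) n F) (sym (∑-applyUpTo suc n (F ∘ g))))

∑-upTo-suc : ∀ n (F : ℕ → ℕ) → ∑ (upTo (suc n)) F ≡ F 0 + ∑[ t ∈ upTo n ] F (suc t)
∑-upTo-suc n F = cong (F 0 +_) (∑-applyUpTo suc n F)

module _ {A : Set} (_≟_ : DecidableEquality A) where

  ∑-𝟙-∉ : ∀ {xs x} → x ∉ xs → ∑[ y ∈ xs ] 𝟙 (y ≟ x) ≡ 0
  ∑-𝟙-∉ {[]}         x∉xs = refl
  ∑-𝟙-∉ {y ∷ xs} {x} x∉xs =
    cong₂ _+_ (𝟙-no (y ≟ x) (λ y≡x → x∉xs (here (sym y≡x)))) (∑-𝟙-∉ (x∉xs ∘ there))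

  ∑-𝟙-∈ : ∀ {xs x} → Unique xs → x ∈ xs → ∑[ y ∈ xs ] 𝟙 (y ≟ x) ≡ 1
  ∑-𝟙-∈ {y ∷ xs}     u           (here refl)  =
    cong₂ _+_ (𝟙-yes (y ≟ y) refl) (∑-𝟙-∉ (Unique[x∷xs]⇒x∉xs u))
  ∑-𝟙-∈ {y ∷ xs} {x} u@(_ ∷ uxs) (there x∈xs) =
    cong₂ _+_ (𝟙-no (y ≟ x) (λ { refl → Unique[x∷xs]⇒x∉xs u x∈xs })) (∑-𝟙-∈ uxs x∈xs)

-- Finite types and finite setoids

record Finite (A : Set) : Set where
  field
    _≟_      : DecidableEquality A
    elems    : List A
    unique   : Unique elems
    complete : ∀ x → x ∈ elems

  open import Data.List.Membership.DecPropositional _≟_ using (_∈?_)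

  ∑-δ : ∀ x → ∑[ y ∈ elems ] 𝟙 (y ≟ x) ≡ 1
  ∑-δ x = ∑-𝟙-∈ _≟_ unique (complete x)

  ∑-select : ∀ x (f : A → ℕ) → ∑[ y ∈ elems ] 𝟙 (y ≟ x) * f y ≡ f x
  ∑-select x f = begin
    ∑[ y ∈ elems ] 𝟙 (y ≟ x) * f y      ≡⟨ ∑-cong elems only-x ⟩
    ∑[ y ∈ elems ] 𝟙 (y ≟ x) * f x      ≡⟨ ∑-*ʳ elems (f x) _ ⟩
    (∑[ y ∈ elems ] 𝟙 (y ≟ x)) * f x    ≡⟨ cong (_* f x) (∑-δ x) ⟩
    1 * f x                             ≡⟨ *-identityˡ (f x) ⟩
    f x                                 ∎
    where
    open ≡-Reasoning
    only-x : ∀ y → 𝟙 (y ≟ x) * f y ≡ 𝟙 (y ≟ x) * f x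
    only-x y with y ≟ x
    ... | yes refl = refl
    ... | no _     = refl

  ∑-reindex : (σ τ : A → A) → (∀ x → τ (σ x) ≡ x) → (∀ y → σ (τ y) ≡ y) →
              ∀ (f : A → ℕ) → ∑[ x ∈ elems ] f (σ x) ≡ ∑ elems f
  ∑-reindex σ τ τσ στ f = begin
    ∑[ x ∈ elems ] f (σ x)                             ≡⟨ ∑-cong elems (λ x → ∑-select (σ x) f) ⟨
    ∑[ x ∈ elems ] ∑[ y ∈ elems ] 𝟙 (y ≟ σ x) * f y    ≡⟨ ∑-swap elems elems _ ⟩
    ∑[ y ∈ elems ] ∑[ x ∈ elems ] 𝟙 (y ≟ σ x) * f y    ≡⟨ ∑-cong elems fibre ⟩
    ∑ elems f                                          ∎
    where
    open ≡-Reasoning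
    fibre : ∀ y → ∑[ x ∈ elems ] 𝟙 (y ≟ σ x) * f y ≡ f y
    fibre y = begin
      ∑[ x ∈ elems ] 𝟙 (y ≟ σ x) * f y    ≡⟨ ∑-*ʳ elems (f y) _ ⟩
      (∑[ x ∈ elems ] 𝟙 (y ≟ σ x)) * f y  ≡⟨ cong (_* f y) (∑-cong elems (λ x → 𝟙-⇔ (y ≟ σ x) (x ≟ τ y) σ⇔τ)) ⟩
      (∑[ x ∈ elems ] 𝟙 (x ≟ τ y)) * f y  ≡⟨ cong (_* f y) (∑-δ (τ y)) ⟩
      1 * f y                             ≡⟨ *-identityˡ (f y) ⟩
      f y                                 ∎
      where
      σ⇔τ : ∀ {x} → y ≡ σ x ⇔ x ≡ τ y
      σ⇔τ {x} = mk⇔ (λ { refl → sym (τσ x) }) (λ { refl → sym (στ y) })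

  ∑-∈ : ∀ {L} → Unique L → ∑[ x ∈ elems ] 𝟙 (x ∈? L) ≡ length L
  ∑-∈ {L} unique-L = begin
    ∑[ x ∈ elems ] 𝟙 (x ∈? L)              ≡⟨ ∑-cong elems spread ⟩
    ∑[ x ∈ elems ] ∑[ y ∈ L ] 𝟙 (y ≟ x)    ≡⟨ ∑-swap elems L _ ⟩
    ∑[ y ∈ L ] ∑[ x ∈ elems ] 𝟙 (y ≟ x)    ≡⟨ ∑-cong L (λ y → trans (∑-cong elems (flip y)) (∑-δ y)) ⟩
    ∑[ y ∈ L ] 1                           ≡⟨ ∑-const L 1 ⟩
    length L * 1                           ≡⟨ *-identityʳ _ ⟩
    length L                               ∎
    where
    open ≡-Reasoning
    spread : ∀ x → 𝟙 (x ∈? L) ≡ ∑[ y ∈ L ] 𝟙 (y ≟ x)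
    spread x with x ∈? L
    ... | yes x∈L = sym (∑-𝟙-∈ _≟_ unique-L x∈L)
    ... | no  x∉L = sym (∑-𝟙-∉ _≟_ x∉L)
    flip : ∀ y x → 𝟙 (y ≟ x) ≡ 𝟙 (x ≟ y)
    flip y x = 𝟙-⇔ (y ≟ x) (x ≟ y) (mk⇔ sym sym)

finite-Fin : ∀ n → Finite (Fin n)
finite-Fin n = record
  { _≟_ = Fin._≟_ ; elems = allFin n ; unique = allFin⁺ n ; complete = ∈-allFin }

finite-Bool : Finite Bool
finite-Bool = record
  { _≟_      = Bool._≟_
  ; elems    = false ∷ true ∷ []
  ; unique   = ((λ ()) ∷ []) ∷ [] ∷ []
  ; complete = λ { false → here refl ; true → there (here refl) }
  }

finite-× : ∀ {A B} → Finite A → Finite B → Finite (A × B)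
finite-× FA FB = record
  { _≟_      = ≡-dec FA._≟_ FB._≟_
  ; elems    = cartesianProduct FA.elems FB.elems
  ; unique   = cartesianProduct⁺ FA.unique FB.unique
  ; complete = λ (a , b) → ∈-cartesianProduct⁺ (FA.complete a) (FB.complete b)
  }
  where
  module FA = Finite FA
  module FB = Finite FB

record Enumeration : Set₁ where
  field
    decSetoid : DecSetoid 0ℓ 0ℓ

  open DecSetoid decSetoid public

  field
    elems        : List Carrier
    counted-once : ∀ x → ∑[ y ∈ elems ] 𝟙 (y ≟ x) ≡ 1

  count : {P : Pred Carrier 0ℓ} → Decidable P → ℕ
  count P? = ∑[ x ∈ elems ] 𝟙 (P? x)

  listed : ∀ x → Any (_≈ x) elems
  listed x = ∑-𝟙⇒Any (_≟ x) elems (λ ∑≡0 → 1+n≢0 (≡.trans (≡.sym (counted-once x)) ∑≡0))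

enumeration : ∀ {A} → Finite A → Enumeration
enumeration F = record
  { decSetoid = ≡.decSetoid _≟_ ; elems = elems ; counted-once = ∑-δ }
  where open Finite F

module _ (X : Enumeration) where
  open Enumeration X using (Carrier; _≈_; _≟_; decSetoid; elems; counted-once)

  module _ {P : Pred Carrier 0ℓ} (P? : Decidable P) where

    withProofs : List Carrier → List (Σ Carrier P)
    withProofs []       = []
    withProofs (x ∷ xs) with P? x
    ... | yes p = (x , p) ∷ withProofs xs
    ... | no _  = withProofs xs

    ∑-withProofs : ∀ xs (f : Carrier → ℕ) →
                   ∑[ y ∈ withProofs xs ] f (proj₁ y) ≡ ∑[ x ∈ xs ] 𝟙 (P? x) * f x
    ∑-withProofs []       f = refl
    ∑-withProofs (x ∷ xs) f with P? x
    ... | yes _ = cong₂ _+_ (sym (+-identityʳ (f x))) (∑-withProofs xs f)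
    ... | no _  = ∑-withProofs xs f

    restrict : P Respects _≈_ → Enumeration
    restrict P-resp = record
      { decSetoid    = On.decSetoid decSetoid proj₁
      ; elems        = withProofs elems
      ; counted-once = λ (x , p) → trans (∑-withProofs elems (λ y → 𝟙 (y ≟ x)))
                                     (trans (∑-cong elems (only x p)) (counted-once x))
      }
      where
      only : ∀ x → P x → ∀ y → 𝟙 (P? y) * 𝟙 (y ≟ x) ≡ 𝟙 (y ≟ x)
      only x p y with y ≟ x
      ... | yes y≈x = cong (_* 1) (𝟙-yes (P? y) (P-resp (Enumeration.sym X y≈x) p))
      ... | no _    = *-zeroʳ (𝟙 (P? y))

module _ (X Y : Enumeration) where
  private
    module X = Enumeration X
    module Y = Enumeration Y

  record Correspondence (P : Pred X.Carrier 0ℓ) (Q : Pred Y.Carrier 0ℓ) : Set where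
    field
      to        : X.Carrier → Y.Carrier
      from      : Y.Carrier → X.Carrier
      to-cong   : ∀ {x x'} → x X.≈ x' → to x Y.≈ to x'
      from-cong : ∀ {y y'} → y Y.≈ y' → from y X.≈ from y'
      to-∈      : ∀ {x} → P x → Q (to x)
      from-∈    : ∀ {y} → Q y → P (from y)
      from∘to   : ∀ {x} → P x → from (to x) X.≈ x
      to∘from   : ∀ {y} → Q y → to (from y) Y.≈ y

  count-correspondence : ∀ {P Q} (P? : Decidable P) (Q? : Decidable Q) →
                         P Respects X._≈_ → Q Respects Y._≈_ →
                         Correspondence P Q → X.count P? ≡ Y.count Q?
  count-correspondence {P} {Q} P? Q? P-resp Q-resp c = begin
    ∑[ x ∈ X.elems ] 𝟙 (P? x)                                      ≡⟨ ∑-cong X.elems spread ⟩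
    ∑[ x ∈ X.elems ] ∑[ y ∈ Y.elems ] 𝟙 (P? x) * 𝟙 (y Y.≟ to x)    ≡⟨ ∑-swap X.elems Y.elems _ ⟩
    ∑[ y ∈ Y.elems ] ∑[ x ∈ X.elems ] 𝟙 (P? x) * 𝟙 (y Y.≟ to x)    ≡⟨ ∑-cong Y.elems fibre ⟩
    ∑[ y ∈ Y.elems ] 𝟙 (Q? y)                                       ∎
    where
    open ≡-Reasoning
    open Correspondence c
    spread : ∀ x → 𝟙 (P? x) ≡ ∑[ y ∈ Y.elems ] 𝟙 (P? x) * 𝟙 (y Y.≟ to x)
    spread x = sym (begin
      ∑[ y ∈ Y.elems ] 𝟙 (P? x) * 𝟙 (y Y.≟ to x)    ≡⟨ ∑-*ˡ Y.elems (𝟙 (P? x)) _ ⟩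
      𝟙 (P? x) * (∑[ y ∈ Y.elems ] 𝟙 (y Y.≟ to x))  ≡⟨ cong (𝟙 (P? x) *_) (Y.counted-once (to x)) ⟩
      𝟙 (P? x) * 1                                  ≡⟨ *-identityʳ _ ⟩
      𝟙 (P? x)                                      ∎)
    fibre : ∀ y → ∑[ x ∈ X.elems ] 𝟙 (P? x) * 𝟙 (y Y.≟ to x) ≡ 𝟙 (Q? y)
    fibre y with Q? y
    ... | yes q = trans (∑-cong X.elems (λ x → trans (sym (𝟙-× (P? x) (y Y.≟ to x)))
                                                     (𝟙-⇔ (P? x ×-dec (y Y.≟ to x)) (x X.≟ from y) (mk⇔ ⇒ ⇐))))
                        (X.counted-once (from y))
      where
      ⇒ : ∀ {x} → P x × y Y.≈ to x → x X.≈ from y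
      ⇒ (p , y≈tox) = X.trans (X.sym (from∘to p)) (from-cong (Y.sym y≈tox))
      ⇐ : ∀ {x} → x X.≈ from y → P x × y Y.≈ to x
      ⇐ x≈fromy = P-resp (X.sym x≈fromy) (from-∈ q) , Y.trans (Y.sym (to∘from q)) (to-cong (X.sym x≈fromy))
    ... | no ¬q = ∑-zero X.elems (λ x → trans (sym (𝟙-× (P? x) (y Y.≟ to x)))
                    (𝟙-no (P? x ×-dec (y Y.≟ to x)) (λ (p , y≈tox) → ¬q (Q-resp (Y.sym y≈tox) (to-∈ p)))))

-- Colourings of a finite set and sums over sub-multisets

-- ∑-subsets ws G is the sum of G (∑ S) over the 2 ^ length ws sub-multisets S of ws.
∑-subsets : List ℕ → (ℕ → ℕ) → ℕ
∑-subsets []       G = G 0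
∑-subsets (w ∷ ws) G = ∑-subsets ws G + ∑-subsets ws (λ s → G (w + s))

subsetsWithSum : List ℕ → ℕ → ℕ
subsetsWithSum ws r = ∑-subsets ws (λ s → 𝟙 (s ≟ℕ r))

weight : {A : Set} → (A → ℕ) → List A → (A → Bool) → ℕ
weight w as f = ∑[ a ∈ as ] w a * bit (f a)

module _ {A : Set} (_≟_ : DecidableEquality A) where

  _[_≔_] : (A → Bool) → A → Bool → A → Bool
  (f [ a ≔ v ]) x = if does (x ≟ a) then v else f x

  functions : List A → List (A → Bool)
  functions []       = (λ _ → false) ∷ []
  functions (a ∷ as) = map (_[ a ≔ false ]) (functions as) ++ map (_[ a ≔ true ]) (functions as)

  Agree : List A → Rel (A → Bool) 0ℓ
  Agree as f g = All (λ a → f a ≡ g a) as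

  private
    update-≡ : ∀ f a v → (f [ a ≔ v ]) a ≡ v
    update-≡ f a v with a ≟ a
    ... | yes _   = refl
    ... | no a≢a = ⊥-elim (a≢a refl)

    update-∉ : ∀ {as} f {a} v → a ∉ as → ∀ {x} → x ∈ as → (f [ a ≔ v ]) x ≡ f x
    update-∉ f {a} v a∉as {x} x∈as with x ≟ a
    ... | yes refl = ⊥-elim (a∉as x∈as)
    ... | no _     = refl

    agree-update : ∀ {as} f g {a} v → a ∉ as →
                   Agree (a ∷ as) (f [ a ≔ v ]) g ⇔ (v ≡ g a × Agree as f g)
    agree-update f g {a} v a∉as = mk⇔
      (λ { (eq ∷ eqs) → trans (sym (update-≡ f a v)) eq
                       , All.tabulate (λ x∈ → trans (sym (update-∉ f v a∉as x∈)) (All.lookup eqs x∈)) })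
      (λ (eq , eqs) → trans (update-≡ f a v) eq
                     ∷ All.tabulate (λ x∈ → trans (update-∉ f v a∉as x∈) (All.lookup eqs x∈)))

    ∑-functions-∷ : ∀ a as (F : (A → Bool) → ℕ) →
                    ∑ (functions (a ∷ as)) F
                      ≡ ∑[ f ∈ functions as ] F (f [ a ≔ false ]) + ∑[ f ∈ functions as ] F (f [ a ≔ true ])
    ∑-functions-∷ a as F = trans (∑-++ (map (_[ a ≔ false ]) (functions as)) _ F)
                                 (cong₂ _+_ (∑-map _ (functions as) F) (∑-map _ (functions as) F))

  functionSpace : (as : List A) → Unique as → Enumeration
  functionSpace as unique = record
    { decSetoid    = record { isDecEquivalence = agree-isDecEquivalence }
    ; elems        = functions as
    ; counted-once = counted-once as unique
    }
    where
    agree? : ∀ as (f g : A → Bool) → Dec (Agree as f g)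
    agree? as f g = all? (λ a → f a Bool.≟ g a) as

    agree-isDecEquivalence : IsDecEquivalence (Agree as)
    agree-isDecEquivalence = record
      { isEquivalence = record
        { refl  = All.tabulate (λ _ → refl)
        ; sym   = All.map sym
        ; trans = λ p q → All.zipWith (uncurry trans) (p , q)
        }
      ; _≟_ = agree? as
      }

    counted-once : ∀ as → Unique as → ∀ g → ∑[ f ∈ functions as ] 𝟙 (agree? as f g) ≡ 1
    counted-once []       _                g = refl
    counted-once (a ∷ as) unique@(_ ∷ uas) g = begin
      ∑[ f ∈ functions (a ∷ as) ] 𝟙 (agree? (a ∷ as) f g)   ≡⟨ ∑-functions-∷ a as _ ⟩
      with-value false + with-value true                     ≡⟨ cong₂ _+_ (counted-with false) (counted-with true) ⟩
      𝟙 (false Bool.≟ g a) + 𝟙 (true Bool.≟ g a)             ≡⟨ one-value (g a) ⟩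
      1                                                      ∎
      where
      open ≡-Reasoning
      with-value : Bool → ℕ
      with-value v = ∑[ f ∈ functions as ] 𝟙 (agree? (a ∷ as) (f [ a ≔ v ]) g)
      counted-with : ∀ v → with-value v ≡ 𝟙 (v Bool.≟ g a)
      counted-with v = begin
        with-value v
          ≡⟨ ∑-cong (functions as) (λ f →
               trans (𝟙-⇔ (agree? (a ∷ as) (f [ a ≔ v ]) g) ((v Bool.≟ g a) ×-dec agree? as f g)
                          (agree-update f g v (Unique[x∷xs]⇒x∉xs unique)))
                     (𝟙-× (v Bool.≟ g a) (agree? as f g))) ⟩
        ∑[ f ∈ functions as ] 𝟙 (v Bool.≟ g a) * 𝟙 (agree? as f g)
          ≡⟨ ∑-*ˡ (functions as) (𝟙 (v Bool.≟ g a)) _ ⟩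
        𝟙 (v Bool.≟ g a) * (∑[ f ∈ functions as ] 𝟙 (agree? as f g))
          ≡⟨ cong (𝟙 (v Bool.≟ g a) *_) (counted-once as uas g) ⟩
        𝟙 (v Bool.≟ g a) * 1
          ≡⟨ *-identityʳ _ ⟩
        𝟙 (v Bool.≟ g a) ∎
      one-value : ∀ b → 𝟙 (false Bool.≟ b) + 𝟙 (true Bool.≟ b) ≡ 1
      one-value false = refl
      one-value true  = refl

  ∑-functions : ∀ (w : A → ℕ) as → Unique as → ∀ G →
                ∑[ f ∈ functions as ] G (weight w as f) ≡ ∑-subsets (map w as) G
  ∑-functions w []       _                G = +-identityʳ (G 0)
  ∑-functions w (a ∷ as) unique@(_ ∷ uas) G = begin
    ∑[ f ∈ functions (a ∷ as) ] G (weight w (a ∷ as) f)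
      ≡⟨ ∑-functions-∷ a as _ ⟩
    ∑[ f ∈ functions as ] G (weight w (a ∷ as) (f [ a ≔ false ]))
      + ∑[ f ∈ functions as ] G (weight w (a ∷ as) (f [ a ≔ true ]))
      ≡⟨ cong₂ _+_ (∑-cong (functions as) (λ f → cong G (split f false)))
                   (∑-cong (functions as) (λ f → cong G (split f true))) ⟩
    ∑[ f ∈ functions as ] G (w a * 0 + weight w as f) + ∑[ f ∈ functions as ] G (w a * 1 + weight w as f)
      ≡⟨ cong₂ _+_ (∑-cong (functions as) (λ f → cong (λ c → G (c + weight w as f)) (*-zeroʳ (w a))))
                   (∑-cong (functions as) (λ f → cong (λ c → G (c + weight w as f)) (*-identityʳ (w a)))) ⟩
    ∑[ f ∈ functions as ] G (weight w as f) + ∑[ f ∈ functions as ] G (w a + weight w as f)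
      ≡⟨ cong₂ _+_ (∑-functions w as uas G) (∑-functions w as uas (λ s → G (w a + s))) ⟩
    ∑-subsets (map w (a ∷ as)) G ∎
    where
    open ≡-Reasoning
    split : ∀ f v → weight w (a ∷ as) (f [ a ≔ v ]) ≡ w a * bit v + weight w as f
    split f v = cong₂ (λ x y → w a * bit x + y) (update-≡ f a v)
                  (∑-cong-∈ as (λ x∈ → cong (λ b → w _ * bit b) (update-∉ f v (Unique[x∷xs]⇒x∉xs unique) x∈)))

∑-subsets-cong : ∀ ws {G H : ℕ → ℕ} → (∀ s → G s ≡ H s) → ∑-subsets ws G ≡ ∑-subsets ws H
∑-subsets-cong []       G≗H = G≗H 0
∑-subsets-cong (w ∷ ws) G≗H = cong₂ _+_ (∑-subsets-cong ws G≗H) (∑-subsets-cong ws (G≗H ∘ (w +_)))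

∑-subsets-zero : ∀ ws {G : ℕ → ℕ} → (∀ s → G s ≡ 0) → ∑-subsets ws G ≡ 0
∑-subsets-zero []       G≡0 = G≡0 0
∑-subsets-zero (w ∷ ws) G≡0 = cong₂ _+_ (∑-subsets-zero ws G≡0) (∑-subsets-zero ws (G≡0 ∘ (w +_)))

∑-subsets-↭ : ∀ {ws vs} → ws ↭ vs → ∀ (G : ℕ → ℕ) → ∑-subsets ws G ≡ ∑-subsets vs G
∑-subsets-↭ ↭.refl         G = refl
∑-subsets-↭ (↭.prep w p)   G = cong₂ _+_ (∑-subsets-↭ p G) (∑-subsets-↭ p (λ s → G (w + s)))
∑-subsets-↭ (↭.trans p q)  G = trans (∑-subsets-↭ p G) (∑-subsets-↭ q G)
∑-subsets-↭ {_ ∷ _ ∷ ws} {_ ∷ _ ∷ vs} (↭.swap x y p) G = begin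
  (S ws G + S ws (G ∘ (y +_))) + (S ws (G ∘ (x +_)) + S ws (G ∘ (x +_) ∘ (y +_)))
    ≡⟨ interchange (S ws G) _ _ _ ⟩
  (S ws G + S ws (G ∘ (x +_))) + (S ws (G ∘ (y +_)) + S ws (G ∘ (x +_) ∘ (y +_)))
    ≡⟨ cong₂ _+_ (cong₂ _+_ (∑-subsets-↭ p G) (∑-subsets-↭ p (G ∘ (x +_))))
                 (cong₂ _+_ (∑-subsets-↭ p (G ∘ (y +_)))
                            (trans (∑-subsets-↭ p (G ∘ (x +_) ∘ (y +_)))
                                   (∑-subsets-cong vs (λ s → cong G (x∙yz≈y∙xz x y s))))) ⟩
  (S vs G + S vs (G ∘ (x +_))) + (S vs (G ∘ (y +_)) + S vs (G ∘ (y +_) ∘ (x +_)))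
    ∎
  where
  open ≡-Reasoning
  S : List ℕ → (ℕ → ℕ) → ℕ
  S = ∑-subsets

map-↭-replicate : ∀ {A : Set} {P : Pred A 0ℓ} (P? : Decidable P) (f : A → ℕ) {a b} →
                  (∀ {x} → P x → f x ≡ a) → (∀ {x} → ¬ P x → f x ≡ b) → ∀ xs →
                  map f xs ↭ replicate (∑[ x ∈ xs ] 𝟙 (P? x)) a ++ replicate (∑[ x ∈ xs ] 𝟙 (¬? (P? x))) b
map-↭-replicate P? f         fa fb []       = ↭.refl
map-↭-replicate P? f {a} {b} fa fb (x ∷ xs) with P? x
... | yes px = subst (λ y → y ∷ map f xs ↭ _) (sym (fa px)) (↭.prep a (map-↭-replicate P? f fa fb xs))
... | no ¬px = subst (λ y → y ∷ map f xs ↭ _) (sym (fb ¬px))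
                 (↭-trans (↭.prep b (map-↭-replicate P? f fa fb xs)) (↭-sym (shift b _ _)))

∑-subsets-replicate : ∀ m d (G : ℕ → ℕ) →
                      ∑-subsets (replicate m d) G ≡ ∑-subsets (replicate m 1) (λ t → G (d * t))
∑-subsets-replicate zero    d G = cong G (sym (*-zeroʳ d))
∑-subsets-replicate (suc m) d G = cong₂ _+_ (∑-subsets-replicate m d G)
  (trans (∑-subsets-replicate m d (λ s → G (d + s)))
         (∑-subsets-cong (replicate m 1) (λ t → cong G (sym (*-suc d t)))))

subsetsWithSum-ones : ∀ m s → subsetsWithSum (replicate m 1) s ≡ m C s
subsetsWithSum-ones zero    zero    = refl
subsetsWithSum-ones zero    (suc s) = sym (k>n⇒nCk≡0 (s≤s (z≤n {s})))
subsetsWithSum-ones (suc m) zero    =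
  cong₂ _+_ (subsetsWithSum-ones m zero) (∑-subsets-zero (replicate m 1) (λ _ → refl))
subsetsWithSum-ones (suc m) (suc s) = begin
  subsetsWithSum (replicate m 1) (suc s) + subsetsWithSum (replicate m 1) s
    ≡⟨ cong₂ _+_ (subsetsWithSum-ones m (suc s)) (subsetsWithSum-ones m s) ⟩
  m C suc s + m C s
    ≡⟨ +-comm (m C suc s) (m C s) ⟩
  m C s + m C suc s
    ≡⟨ nCk+nC[k+1]≡[n+1]C[k+1] m s ⟩
  suc m C suc s ∎
  where open ≡-Reasoning

subsetsWithSum-replicate : ∀ m s d .{{_ : NonZero d}} → subsetsWithSum (replicate m d) s ≡ binomFrac m s d
subsetsWithSum-replicate m s d with s % d ≟ℕ 0
... | yes s%d≡0 = begin
  subsetsWithSum (replicate m d) s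
    ≡⟨ ∑-subsets-replicate m d _ ⟩
  ∑-subsets (replicate m 1) (λ t → 𝟙 (d * t ≟ℕ s))
    ≡⟨ ∑-subsets-cong (replicate m 1) (λ t → 𝟙-⇔ (d * t ≟ℕ s) (t ≟ℕ s / d) (mk⇔
         (λ dt≡s → *-cancelˡ-≡ t (s / d) d (trans dt≡s s≡d*[s/d]))
         (λ { refl → sym s≡d*[s/d] }))) ⟩
  subsetsWithSum (replicate m 1) (s / d)
    ≡⟨ subsetsWithSum-ones m (s / d) ⟩
  m C (s / d) ∎
  where
  open ≡-Reasoning
  s≡d*[s/d] : s ≡ d * (s / d)
  s≡d*[s/d] = trans (m≡m%n+[m/n]*n s d) (trans (cong (_+ (s / d) * d) s%d≡0) (*-comm (s / d) d))
... | no s%d≢0 = trans (∑-subsets-replicate m d _) (∑-subsets-zero (replicate m 1) (λ t →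
  𝟙-no (d * t ≟ℕ s) (λ dt≡s → s%d≢0 (trans (cong (_% d) (trans (sym dt≡s) (*-comm d t))) (m*n%n≡0 t d)))))

subsetsWithSum-ones-++ : ∀ f ws r →
  subsetsWithSum (replicate f 1 ++ ws) r ≡ ∑[ t ∈ upTo (suc r) ] (f C t) * subsetsWithSum ws (r ∸ t)
subsetsWithSum-ones-++ zero    ws r = sym (begin
  ∑[ t ∈ upTo (suc r) ] (0 C t) * V (r ∸ t)
    ≡⟨ ∑-upTo-suc r (λ t → (0 C t) * V (r ∸ t)) ⟩
  1 * V r + ∑[ t ∈ upTo r ] (0 C suc t) * V (r ∸ suc t)
    ≡⟨ cong₂ _+_ (*-identityˡ (V r)) (∑-zero (upTo r) (λ t → cong (_* V (r ∸ suc t)) (k>n⇒nCk≡0 (s≤s (z≤n {t}))))) ⟩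
  V r + 0
    ≡⟨ +-identityʳ (V r) ⟩
  V r ∎)
  where
  open ≡-Reasoning
  V : ℕ → ℕ
  V = subsetsWithSum ws
subsetsWithSum-ones-++ (suc f) ws zero =
  trans (cong₂ _+_ (subsetsWithSum-ones-++ f ws 0) (∑-subsets-zero (replicate f 1 ++ ws) (λ _ → refl)))
        (+-identityʳ _)
subsetsWithSum-ones-++ (suc f) ws (suc r) = begin
  subsetsWithSum (replicate f 1 ++ ws) (suc r) + subsetsWithSum (replicate f 1 ++ ws) r
    ≡⟨ cong₂ _+_ (subsetsWithSum-ones-++ f ws (suc r)) (subsetsWithSum-ones-++ f ws r) ⟩
  ∑[ t ∈ upTo (suc (suc r)) ] (f C t) * V (suc r ∸ t) + Σ₀
    ≡⟨ cong (_+ Σ₀) (∑-upTo-suc (suc r) (λ t → (f C t) * V (suc r ∸ t))) ⟩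
  (1 * V (suc r) + Σ₁) + Σ₀
    ≡⟨ x∙yz≈xz∙y (1 * V (suc r)) Σ₀ Σ₁ ⟨
  1 * V (suc r) + (Σ₀ + Σ₁)
    ≡⟨ cong (1 * V (suc r) +_) (∑-+ (upTo (suc r)) (λ t → (f C t) * V (r ∸ t)) (λ t → (f C suc t) * V (r ∸ t))) ⟨
  1 * V (suc r) + ∑[ t ∈ upTo (suc r) ] ((f C t) * V (r ∸ t) + (f C suc t) * V (r ∸ t))
    ≡⟨ cong (1 * V (suc r) +_) (∑-cong (upTo (suc r)) pascal) ⟩
  1 * V (suc r) + ∑[ t ∈ upTo (suc r) ] (suc f C suc t) * V (r ∸ t)
    ≡⟨ ∑-upTo-suc (suc r) (λ t → (suc f C t) * V (suc r ∸ t)) ⟨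
  ∑[ t ∈ upTo (suc (suc r)) ] (suc f C t) * V (suc r ∸ t) ∎
  where
  open ≡-Reasoning
  V : ℕ → ℕ
  V = subsetsWithSum ws
  Σ₀ Σ₁ : ℕ
  Σ₀ = ∑[ t ∈ upTo (suc r) ] (f C t) * V (r ∸ t)
  Σ₁ = ∑[ t ∈ upTo (suc r) ] (f C suc t) * V (r ∸ t)
  pascal : ∀ t → (f C t) * V (r ∸ t) + (f C suc t) * V (r ∸ t) ≡ (suc f C suc t) * V (r ∸ t)
  pascal t = trans (sym (*-distribʳ-+ (V (r ∸ t)) (f C t) (f C suc t)))
                   (cong (_* V (r ∸ t)) (nCk+nC[k+1]≡[n+1]C[k+1] f t))

data Parity : ℕ → Set where
  even : ∀ q → Parity (q * 2)
  odd  : ∀ q → Parity (suc (q * 2))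

parity : ∀ n → Parity n
parity zero    = even 0
parity (suc n) with parity n
... | even q = odd q
... | odd q  = even (suc q)

binomFrac-multiple : ∀ m q d .{{_ : NonZero d}} → binomFrac m (q * d) d ≡ m C q
binomFrac-multiple m q d with (q * d) % d ≟ℕ 0
... | yes _     = cong (m C_) (m*n/n≡m q d)
... | no qd%d≢0 = ⊥-elim (qd%d≢0 (m*n%n≡0 q d))

binomFrac-odd : ∀ m q → binomFrac m (suc (q * 2)) 2 ≡ 0
binomFrac-odd m q with suc (q * 2) % 2 ≟ℕ 0
... | yes odd%2≡0 = ⊥-elim (1+n≢0 (trans (sym ([m+kn]%n≡m%n 1 q 2)) odd%2≡0))
... | no _        = refl

binomFrac-consecutive : ∀ m r → binomFrac m (suc r) 2 + binomFrac m r 2 ≡ m C (suc r / 2)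
binomFrac-consecutive m r with parity r
... | even q = trans (cong₂ _+_ (binomFrac-odd m q) (binomFrac-multiple m q 2))
                     (cong (m C_) (sym (trans (+-distrib-/-∣ʳ 1 {d = 2} (divides q refl)) (m*n/n≡m q 2))))
... | odd q  = trans (cong₂ _+_ (binomFrac-multiple m (suc q) 2) (binomFrac-odd m q))
                     (trans (+-identityʳ _) (cong (m C_) (sym (m*n/n≡m (suc q) 2))))

-- Quotients of finite setoids and Burnside's lemma

module _ (S : Setoid 0ℓ 0ℓ) where
  open Setoid S using (_≈_) renaming (sym to ≈-sym)

  lookup-injective : ∀ {xs} → Unique≈ S xs → ∀ i j → lookup xs i ≈ lookup xs j → i ≡ j
  lookup-injective (_ ∷ _)    Fin.zero    Fin.zero    _  = refl
  lookup-injective (x≉xs ∷ _) Fin.zero    (Fin.suc j) x≈ = ⊥-elim (All.lookup x≉xs (∈-lookup j) x≈)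
  lookup-injective (x≉xs ∷ _) (Fin.suc i) Fin.zero    ≈x = ⊥-elim (All.lookup x≉xs (∈-lookup i) (≈-sym ≈x))
  lookup-injective (_ ∷ uxs)  (Fin.suc i) (Fin.suc j) eq = cong Fin.suc (lookup-injective uxs i j eq)

module Quotient (X : Enumeration) {_∼_ : Rel (Enumeration.Carrier X) 0ℓ}
                (∼-isDecEquivalence : IsDecEquivalence _∼_)
                (≈⇒∼ : ∀ {x y} → Enumeration._≈_ X x y → x ∼ y) where

  open Enumeration X using (Carrier; _≈_; elems; listed; count)

  ∼-decSetoid : DecSetoid 0ℓ 0ℓ
  ∼-decSetoid = record { isDecEquivalence = ∼-isDecEquivalence }

  open DecSetoid ∼-decSetoid public using ()
    renaming (_≟_ to _∼?_; refl to ∼-refl; sym to ∼-sym; trans to ∼-trans)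
  open DecSetoid ∼-decSetoid using () renaming (setoid to ∼-setoid)

  representatives : List Carrier
  representatives = deduplicate _∼?_ elems

  classes : ℕ
  classes = length representatives

  representative : Fin classes → Carrier
  representative = lookup representatives

  private
    represented : ∀ x → Any (x ∼_) representatives
    represented = deduplicate⁺ ∼-decSetoid (λ x → Any.map (λ y≈x → ≈⇒∼ (Enumeration.sym X y≈x)) (listed x))

  class : Carrier → Fin classes
  class x = Any.index (represented x)

  canonical : Carrier → Carrier
  canonical x = representative (class x)

  ∼-canonical : ∀ x → x ∼ canonical x
  ∼-canonical x = lookup-index (represented x)

  representative-injective : ∀ i j → representative i ∼ representative j → i ≡ j
  representative-injective = lookup-injective ∼-setoid (deduplicate-! ∼-decSetoid elems)

  class-representative : ∀ i → class (representative i) ≡ i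
  class-representative i = representative-injective _ _ (∼-sym (∼-canonical (representative i)))

  class-≡⇔∼ : ∀ {x y} → class x ≡ class y ⇔ x ∼ y
  class-≡⇔∼ {x} {y} = mk⇔
    (λ cx≡cy → ∼-trans (∼-canonical x) (subst (λ i → representative i ∼ y) (sym cx≡cy) (∼-sym (∼-canonical y))))
    (λ x∼y → representative-injective _ _ (∼-trans (∼-sym (∼-canonical x)) (∼-trans x∼y (∼-canonical y))))

  class-cong : ∀ {x y} → x ≈ y → class x ≡ class y
  class-cong = Equivalence.from class-≡⇔∼ ∘ ≈⇒∼

  classSize : Fin classes → ℕ
  classSize i = count (λ x → i Fin.≟ class x)

  ∑-class : ∀ (F : Fin classes → ℕ) → ∑[ x ∈ elems ] F (class x) ≡ ∑[ i ∈ allFin classes ] classSize i * F i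
  ∑-class F = begin
    ∑[ x ∈ elems ] F (class x)
      ≡⟨ ∑-cong elems (λ x → Finite.∑-select (finite-Fin classes) (class x) F) ⟨
    ∑[ x ∈ elems ] ∑[ i ∈ allFin classes ] 𝟙 (i Fin.≟ class x) * F i
      ≡⟨ ∑-swap elems (allFin classes) _ ⟩
    ∑[ i ∈ allFin classes ] ∑[ x ∈ elems ] 𝟙 (i Fin.≟ class x) * F i
      ≡⟨ ∑-cong (allFin classes) (λ i → ∑-*ʳ elems (F i) _) ⟩
    ∑[ i ∈ allFin classes ] classSize i * F i ∎
    where open ≡-Reasoning

module _ {G : Set} (_∙_ : Op₂ G) (ε : G) (X : Enumeration) where
  open Enumeration X using (Carrier; _≈_)

  record Action : Set where
    field
      _⋆_    : G → Carrier → Carrier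
      ⋆-cong : ∀ g {x y} → x ≈ y → g ⋆ x ≈ g ⋆ y
      ε-⋆    : ∀ x → ε ⋆ x ≈ x
      ∙-⋆    : ∀ g h x → (g ∙ h) ⋆ x ≈ g ⋆ (h ⋆ x)

-- Instead of orbit–stabiliser: writing x ≈ h ⋆ canonical x, right translation by h is a bijection
-- from the stabiliser of x onto {g | g ⋆ canonical x ≈ x}, and for each g the x with
-- g ⋆ canonical x ≈ x are in bijection with the classes.
module Burnside
  {G : Set} (finiteG : Finite G)
  {_∙_ : Op₂ G} {ε : G} {_⁻¹ : Op₁ G} (isGroup : IsGroup _≡_ _∙_ ε _⁻¹)
  (X : Enumeration) (action : Action _∙_ ε X)
  where

  open Enumeration X using (Carrier; _≈_; _≟_; elems; count; reflexive)
    renaming (refl to ≈-refl; sym to ≈-sym; trans to ≈-trans)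
  open Action action
  open Finite finiteG using (∑-reindex) renaming (elems to group; complete to group-complete)
  open IsGroup isGroup using (inverseˡ)

  private
    G-group : Group 0ℓ 0ℓ
    G-group = record { isGroup = isGroup }

  open GroupProperties G-group using (//-rightDividesˡ; //-rightDividesʳ)

  _∼_ : Rel Carrier 0ℓ
  x ∼ y = ∃[ g ] y ≈ g ⋆ x

  private
    cancel : ∀ g x → (g ⁻¹) ⋆ (g ⋆ x) ≈ x
    cancel g x = ≈-trans (≈-sym (∙-⋆ (g ⁻¹) g x)) (≈-trans (reflexive (cong (_⋆ x) (inverseˡ g))) (ε-⋆ x))

  ∼-isDecEquivalence : IsDecEquivalence _∼_
  ∼-isDecEquivalence = record
    { isEquivalence = record
      { refl  = λ {x} → ε , ≈-sym (ε-⋆ x)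
      ; sym   = λ { {x} (g , y≈gx) → g ⁻¹ , ≈-sym (≈-trans (⋆-cong (g ⁻¹) y≈gx) (cancel g x)) }
      ; trans = λ { (g , y≈gx) (h , z≈hy) → h ∙ g , ≈-trans z≈hy (≈-trans (⋆-cong h y≈gx) (≈-sym (∙-⋆ h g _))) }
      }
    ; _≟_ = λ x y → map′ Any.satisfied (λ (g , y≈gx) → lose (group-complete g) y≈gx)
                         (any? (λ g → y ≟ g ⋆ x) group)
    }

  ≈⇒∼ : ∀ {x y} → x ≈ y → x ∼ y
  ≈⇒∼ {x} x≈y = ε , ≈-trans (≈-sym x≈y) (≈-sym (ε-⋆ x))

  open Quotient X ∼-isDecEquivalence ≈⇒∼ public

  stabiliser-size : ∀ x → ∑[ g ∈ group ] 𝟙 (g ⋆ x ≟ x) ≡ ∑[ g ∈ group ] 𝟙 (g ⋆ canonical x ≟ x)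
  stabiliser-size x = begin
    ∑[ g ∈ group ] 𝟙 (g ⋆ x ≟ x)
      ≡⟨ ∑-cong group (λ g → 𝟙-⇔ (g ⋆ x ≟ x) ((g ∙ h) ⋆ canonical x ≟ x)
                                 (mk⇔ (≈-trans (translate g)) (≈-trans (≈-sym (translate g))))) ⟩
    ∑[ g ∈ group ] 𝟙 ((g ∙ h) ⋆ canonical x ≟ x)
      ≡⟨ ∑-reindex (_∙ h) (λ g → g ∙ (h ⁻¹)) (//-rightDividesʳ h) (//-rightDividesˡ h)
                   (λ g → 𝟙 (g ⋆ canonical x ≟ x)) ⟩
    ∑[ g ∈ group ] 𝟙 (g ⋆ canonical x ≟ x) ∎
    where
    open ≡-Reasoning
    h : G
    h = proj₁ (∼-sym (∼-canonical x))
    translate : ∀ g → (g ∙ h) ⋆ canonical x ≈ g ⋆ x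
    translate g = ≈-trans (∙-⋆ g h (canonical x)) (⋆-cong g (≈-sym (proj₂ (∼-sym (∼-canonical x)))))

  fixed-by-canonical : ∀ g → count (λ x → g ⋆ canonical x ≟ x) ≡ classes
  fixed-by-canonical g = begin
    count (λ x → g ⋆ canonical x ≟ x)   ≡⟨ count-correspondence X (enumeration (finite-Fin classes))
                                             (λ x → g ⋆ canonical x ≟ x) (λ _ → yes tt) respects (λ _ _ → tt)
                                             correspondence ⟩
    ∑[ i ∈ allFin classes ] 1           ≡⟨ ∑-allFin-const classes 1 ⟩
    classes * 1                         ≡⟨ *-identityʳ classes ⟩
    classes                             ∎
    where
    open ≡-Reasoning
    class-⋆-representative : ∀ i → class (g ⋆ representative i) ≡ i
    class-⋆-representative i = trans (sym (Equivalence.from class-≡⇔∼ (g , ≈-refl))) (class-representative i)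
    respects : ∀ {x y} → x ≈ y → g ⋆ canonical x ≈ x → g ⋆ canonical y ≈ y
    respects x≈y fixed =
      ≈-trans (reflexive (cong (λ i → g ⋆ representative i) (sym (class-cong x≈y)))) (≈-trans fixed x≈y)
    correspondence : Correspondence X (enumeration (finite-Fin classes)) (λ x → g ⋆ canonical x ≈ x) (λ _ → _)
    correspondence = record
      { to        = class
      ; from      = λ i → g ⋆ representative i
      ; to-cong   = class-cong
      ; from-cong = λ { refl → ≈-refl }
      ; to-∈      = λ _ → tt
      ; from-∈    = λ {i} _ → ⋆-cong g (reflexive (cong representative (class-⋆-representative i)))
      ; from∘to   = λ fixed → fixed
      ; to∘from   = λ {i} _ → class-⋆-representative i
      }

  burnside : ∑[ g ∈ group ] count (λ x → g ⋆ x ≟ x) ≡ length group * classes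
  burnside = begin
    ∑[ g ∈ group ] ∑[ x ∈ elems ] 𝟙 (g ⋆ x ≟ x)              ≡⟨ ∑-swap group elems _ ⟩
    ∑[ x ∈ elems ] ∑[ g ∈ group ] 𝟙 (g ⋆ x ≟ x)              ≡⟨ ∑-cong elems stabiliser-size ⟩
    ∑[ x ∈ elems ] ∑[ g ∈ group ] 𝟙 (g ⋆ canonical x ≟ x)    ≡⟨ ∑-swap elems group _ ⟩
    ∑[ g ∈ group ] ∑[ x ∈ elems ] 𝟙 (g ⋆ canonical x ≟ x)    ≡⟨ ∑-cong group fixed-by-canonical ⟩
    ∑[ g ∈ group ] classes                                    ≡⟨ ∑-const group classes ⟩
    length group * classes                                    ∎
    where open ≡-Reasoning

-- Colourings invariant under a cyclic group

infixr 8 _^_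

_^_ : {A : Set} → (A → A) → ℕ → A → A
_^_ {A} = Endo._^_ A

^-+ : ∀ {A : Set} (f : A → A) m n x → (f ^ (m + n)) x ≡ (f ^ m) ((f ^ n) x)
^-+ {A} f m n = cong-app (Endo.^-homo A f m n)

module CyclicAction {E : Set} (finiteE : Finite E)
  (g : E → E) (d : ℕ) .{{_ : NonZero d}}
  (period : ∀ c → (g ^ d) c ≡ c)
  (free : ∀ c → g c ≢ c → ∀ {i} → 0 < i → i < d → (g ^ i) c ≢ c)
  where

  open Finite finiteE
  open import Data.List.Membership.DecPropositional _≟_ using (_∈?_)

  private
    ^-period : ∀ q c → (g ^ (d * q)) c ≡ c
    ^-period zero    c = cong (λ i → (g ^ i) c) (*-zeroʳ d)
    ^-period (suc q) c = begin
      (g ^ (d * suc q)) c       ≡⟨ cong (λ i → (g ^ i) c) (*-suc d q) ⟩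
      (g ^ (d + d * q)) c       ≡⟨ ^-+ g d (d * q) c ⟩
      (g ^ d) ((g ^ (d * q)) c) ≡⟨ cong (g ^ d) (^-period q c) ⟩
      (g ^ d) c                 ≡⟨ period c ⟩
      c                         ∎
      where open ≡-Reasoning

    ^-mod : ∀ i c → (g ^ i) c ≡ (g ^ (i % d)) c
    ^-mod i c = begin
      (g ^ i) c                                 ≡⟨ cong (λ j → (g ^ j) c) (m≡m%n+[m/n]*n i d) ⟩
      (g ^ (i % d + i / d * d)) c               ≡⟨ ^-+ g (i % d) (i / d * d) c ⟩
      (g ^ (i % d)) ((g ^ (i / d * d)) c)       ≡⟨ cong (λ j → (g ^ (i % d)) ((g ^ j) c)) (*-comm (i / d) d) ⟩
      (g ^ (i % d)) ((g ^ (d * (i / d))) c)     ≡⟨ cong (g ^ (i % d)) (^-period (i / d) c) ⟩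
      (g ^ (i % d)) c                           ∎
      where open ≡-Reasoning

  _∼_ : Rel E 0ℓ
  c ∼ c' = ∃[ i ] c' ≡ (g ^ i) c

  orbit : E → List E
  orbit c = applyUpTo (λ i → (g ^ i) c) d

  ∼⇔∈orbit : ∀ {c c'} → c ∼ c' ⇔ c' ∈ orbit c
  ∼⇔∈orbit {c} = mk⇔
    (λ (i , c'≡) → subst (_∈ orbit c) (sym (trans c'≡ (^-mod i c))) (∈-applyUpTo⁺ (λ i → (g ^ i) c) (m%n<n i d)))
    (λ c'∈ → let (i , _ , c'≡) = ∈-applyUpTo⁻ (λ i → (g ^ i) c) c'∈ in i , c'≡)

  ∼-isDecEquivalence : IsDecEquivalence _∼_
  ∼-isDecEquivalence = record
    { isEquivalence = record
      { refl  = 0 , refl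
      ; sym   = λ { {c} {c'} (i , refl) → pred d * i , sym (back i c) }
      ; trans = λ { {c} (i , refl) (j , refl) → j + i , sym (^-+ g j i c) }
      }
    ; _≟_ = λ c c' → map′ (Equivalence.from ∼⇔∈orbit) (Equivalence.to ∼⇔∈orbit) (c' ∈? orbit c)
    }
    where
    back : ∀ i c → (g ^ (pred d * i)) ((g ^ i) c) ≡ c
    back i c = begin
      (g ^ (pred d * i)) ((g ^ i) c)   ≡⟨ ^-+ g (pred d * i) i c ⟨
      (g ^ (pred d * i + i)) c         ≡⟨ cong (λ j → (g ^ j) c) (trans (+-comm (pred d * i) i)
                                                                  (cong (_* i) (suc-pred d))) ⟩
      (g ^ (d * i)) c                  ≡⟨ ^-period i c ⟩
      c                                ∎
      where open ≡-Reasoning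

  ≡⇒∼ : ∀ {c c'} → c ≡ c' → c ∼ c'
  ≡⇒∼ refl = 0 , refl

  open Quotient (enumeration finiteE) ∼-isDecEquivalence ≡⇒∼ public

  fixed-^ : ∀ {c} → g c ≡ c → ∀ i → (g ^ i) c ≡ c
  fixed-^ gc≡c zero    = refl
  fixed-^ gc≡c (suc i) = trans (cong g (fixed-^ gc≡c i)) gc≡c

  fixed-∼ : ∀ {c c'} → g c ≡ c → c ∼ c' → c' ≡ c
  fixed-∼ gc≡c (i , refl) = fixed-^ gc≡c i

  fixed-invariant : ∀ {c c'} → c ∼ c' → g c ≡ c → g c' ≡ c'
  fixed-invariant c∼c' gc≡c rewrite fixed-∼ gc≡c c∼c' = gc≡c

  private
    in-class : ∀ {i c} → i ≡ class c ⇔ representative i ∼ c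
    in-class {i} {c} = mk⇔
      (λ i≡ → Equivalence.to class-≡⇔∼ (trans (class-representative i) i≡))
      (λ r∼c → trans (sym (class-representative i)) (Equivalence.from class-≡⇔∼ r∼c))

  classSize-fixed : ∀ i → g (representative i) ≡ representative i → classSize i ≡ 1
  classSize-fixed i fixed = trans
    (∑-cong elems (λ c → 𝟙-⇔ (i Fin.≟ class c) (c ≟ representative i)
      (mk⇔ (λ i≡ → fixed-∼ fixed (Equivalence.to in-class i≡))
           (λ { refl → Equivalence.from in-class ∼-refl }))))
    (∑-δ (representative i))

  orbit-unique : ∀ {c} → g c ≢ c → Unique (orbit c)
  orbit-unique {c} moved = applyUpTo⁺₁ (λ i → (g ^ i) c) d distinct
    where
    distinct : ∀ {i j} → i < j → j < d → (g ^ i) c ≢ (g ^ j) c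
    distinct {i} {j} i<j j<d gⁱc≡gʲc = free c moved 0<k k<d returns
      where
      j+[d∸j]≡d : d ∸ j + j ≡ d
      j+[d∸j]≡d = m∸n+n≡m (<⇒≤ j<d)
      0<k : 0 < d ∸ j + i
      0<k = <-≤-trans (m<n⇒0<n∸m j<d) (m≤m+n (d ∸ j) i)
      k<d : d ∸ j + i < d
      k<d = subst (d ∸ j + i <_) j+[d∸j]≡d (+-monoʳ-< (d ∸ j) i<j)
      returns : (g ^ (d ∸ j + i)) c ≡ c
      returns = begin
        (g ^ (d ∸ j + i)) c          ≡⟨ ^-+ g (d ∸ j) i c ⟩
        (g ^ (d ∸ j)) ((g ^ i) c)    ≡⟨ cong (g ^ (d ∸ j)) gⁱc≡gʲc ⟩
        (g ^ (d ∸ j)) ((g ^ j) c)    ≡⟨ ^-+ g (d ∸ j) j c ⟨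
        (g ^ (d ∸ j + j)) c          ≡⟨ cong (λ k → (g ^ k) c) j+[d∸j]≡d ⟩
        (g ^ d) c                    ≡⟨ period c ⟩
        c                            ∎
        where open ≡-Reasoning

  classSize-moved : ∀ i → g (representative i) ≢ representative i → classSize i ≡ d
  classSize-moved i moved = begin
    classSize i
      ≡⟨ ∑-cong elems (λ c → 𝟙-⇔ (i Fin.≟ class c) (c ∈? orbit (representative i))
                                 (mk⇔ (Equivalence.to ∼⇔∈orbit ∘ Equivalence.to in-class)
                                      (Equivalence.from in-class ∘ Equivalence.from ∼⇔∈orbit))) ⟩
    ∑[ c ∈ elems ] 𝟙 (c ∈? orbit (representative i))
      ≡⟨ ∑-∈ (orbit-unique moved) ⟩
    length (orbit (representative i))
      ≡⟨ length-applyUpTo _ d ⟩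
    d ∎
    where open ≡-Reasoning

  fixedPoints : ℕ
  fixedPoints = ∑[ c ∈ elems ] 𝟙 (g c ≟ c)

  private
    fixedᶜ? : Decidable (λ i → g (representative i) ≡ representative i)
    fixedᶜ? i = g (representative i) ≟ representative i

  movedOrbits : ℕ
  movedOrbits = ∑[ i ∈ allFin classes ] 𝟙 (¬? (fixedᶜ? i))

  private
    fixed-orbits : ∑[ i ∈ allFin classes ] 𝟙 (fixedᶜ? i) ≡ fixedPoints
    fixed-orbits = sym (begin
      ∑[ c ∈ elems ] 𝟙 (g c ≟ c)                          ≡⟨ ∑-cong elems (λ c → 𝟙-⇔ (g c ≟ c) (fixedᶜ? (class c))
                                                              (mk⇔ (fixed-invariant (∼-canonical c))
                                                                   (fixed-invariant (∼-sym (∼-canonical c))))) ⟩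
      ∑[ c ∈ elems ] 𝟙 (fixedᶜ? (class c))                ≡⟨ ∑-class (λ i → 𝟙 (fixedᶜ? i)) ⟩
      ∑[ i ∈ allFin classes ] classSize i * 𝟙 (fixedᶜ? i)  ≡⟨ ∑-cong (allFin classes) singleton ⟩
      ∑[ i ∈ allFin classes ] 𝟙 (fixedᶜ? i)                ∎)
      where
      open ≡-Reasoning
      singleton : ∀ i → classSize i * 𝟙 (fixedᶜ? i) ≡ 𝟙 (fixedᶜ? i)
      singleton i with fixedᶜ? i
      ... | yes fixed = cong (_* 1) (classSize-fixed i fixed)
      ... | no _      = *-zeroʳ (classSize i)

  classSize-↭ : map classSize (allFin classes) ↭ replicate fixedPoints 1 ++ replicate movedOrbits d
  classSize-↭ = subst (λ f → map classSize (allFin classes) ↭ replicate f 1 ++ replicate movedOrbits d)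
    fixed-orbits (map-↭-replicate fixedᶜ? classSize (classSize-fixed _) (classSize-moved _) (allFin classes))

  size : length elems ≡ fixedPoints + movedOrbits * d
  size = begin
    length elems                                        ≡⟨ *-identityʳ _ ⟨
    length elems * 1                                    ≡⟨ ∑-const elems 1 ⟨
    ∑[ c ∈ elems ] 1                                    ≡⟨ ∑-class (λ _ → 1) ⟩
    ∑[ i ∈ allFin classes ] classSize i * 1             ≡⟨ ∑-cong (allFin classes) split ⟩
    ∑[ i ∈ allFin classes ] (𝟙 (fixedᶜ? i) + 𝟙 (¬? (fixedᶜ? i)) * d)
                                                        ≡⟨ ∑-+ (allFin classes) _ _ ⟩
    ∑[ i ∈ allFin classes ] 𝟙 (fixedᶜ? i) + ∑[ i ∈ allFin classes ] 𝟙 (¬? (fixedᶜ? i)) * d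
                                                        ≡⟨ cong₂ _+_ fixed-orbits (∑-*ʳ (allFin classes) d _) ⟩
    fixedPoints + movedOrbits * d                       ∎
    where
    open ≡-Reasoning
    split : ∀ i → classSize i * 1 ≡ 𝟙 (fixedᶜ? i) + 𝟙 (¬? (fixedᶜ? i)) * d
    split i with fixedᶜ? i
    ... | yes fixed = cong (_* 1) (classSize-fixed i fixed)
    ... | no moved  = trans (*-identityʳ _) (trans (classSize-moved i moved) (sym (+-identityʳ d)))

  colourings : Enumeration
  colourings = functionSpace _≟_ elems unique

  orbitColourings : Enumeration
  orbitColourings = functionSpace Fin._≟_ (allFin classes) (allFin⁺ classes)

  Invariant : Pred (E → Bool) 0ℓ
  Invariant b = Agree _≟_ elems (b ∘ g) b

  invariant? : Decidable Invariant
  invariant? b = Enumeration._≟_ colourings (b ∘ g) b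

  ones : (E → Bool) → ℕ
  ones b = ∑[ c ∈ elems ] bit (b c)

  invariant-∼ : ∀ {b} → Invariant b → ∀ {c c'} → c ∼ c' → b c' ≡ b c
  invariant-∼ {b} inv {c} (i , refl) = along i
    where
    along : ∀ i → b ((g ^ i) c) ≡ b c
    along zero    = refl
    along (suc i) = trans (All.lookup inv (complete ((g ^ i) c))) (along i)

  invariant-count : ∀ r →
    Enumeration.count colourings (λ b → invariant? b ×-dec ones b ≟ℕ r)
      ≡ subsetsWithSum (replicate fixedPoints 1 ++ replicate movedOrbits d) r
  invariant-count r = begin
    Enumeration.count colourings (λ b → invariant? b ×-dec ones b ≟ℕ r)
      ≡⟨ count-correspondence colourings orbitColourings (λ b → invariant? b ×-dec ones b ≟ℕ r)
           (λ h → weight classSize (allFin classes) h ≟ℕ r) P-respects Q-respects correspondence ⟩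
    ∑[ h ∈ functions Fin._≟_ (allFin classes) ] 𝟙 (weight classSize (allFin classes) h ≟ℕ r)
      ≡⟨ ∑-functions Fin._≟_ classSize (allFin classes) (allFin⁺ classes) (λ s → 𝟙 (s ≟ℕ r)) ⟩
    subsetsWithSum (map classSize (allFin classes)) r
      ≡⟨ ∑-subsets-↭ classSize-↭ (λ s → 𝟙 (s ≟ℕ r)) ⟩
    subsetsWithSum (replicate fixedPoints 1 ++ replicate movedOrbits d) r ∎
    where
    open ≡-Reasoning
    P : Pred (E → Bool) 0ℓ
    P b = Invariant b × ones b ≡ r
    Q : Pred (Fin classes → Bool) 0ℓ
    Q h = weight classSize (allFin classes) h ≡ r

    P-respects : ∀ {b b'} → Agree _≟_ elems b b' → P b → P b'
    P-respects {b} {b'} b≐b' (inv , ones≡r) =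
        All.tabulate (λ {c} c∈ → trans (sym (All.lookup b≐b' (complete (g c))))
                                       (trans (All.lookup inv c∈) (All.lookup b≐b' c∈)))
      , trans (∑-cong-∈ elems (λ c∈ → cong bit (sym (All.lookup b≐b' c∈)))) ones≡r
    Q-respects : ∀ {h h'} → Agree Fin._≟_ (allFin classes) h h' → Q h → Q h'
    Q-respects h≐h' w≡r =
      trans (∑-cong-∈ (allFin classes) (λ {i} i∈ → cong (λ v → classSize i * bit v) (sym (All.lookup h≐h' i∈)))) w≡r

    ones-pullback : ∀ h → ones (h ∘ class) ≡ weight classSize (allFin classes) h
    ones-pullback h = ∑-class (bit ∘ h)

    correspondence : Correspondence colourings orbitColourings P Q
    correspondence = record
      { to        = λ b → b ∘ representative
      ; from      = λ h → h ∘ class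
      ; to-cong   = λ b≐b' → All.tabulate (λ {i} _ → All.lookup b≐b' (complete (representative i)))
      ; from-cong = λ h≐h' → All.tabulate (λ {c} _ → All.lookup h≐h' (∈-allFin (class c)))
      ; to-∈      = λ {b} (inv , ones≡r) → trans (sym (ones-pullback (b ∘ representative)))
                      (trans (∑-cong elems (λ c → cong bit (invariant-∼ inv (∼-canonical c)))) ones≡r)
      ; from-∈    = λ {h} w≡r → All.tabulate (λ {c} _ → cong h (Equivalence.from class-≡⇔∼ (∼-sym (1 , refl))))
                      , trans (ones-pullback h) w≡r
      ; from∘to   = λ (inv , _) → All.tabulate (λ {c} _ → invariant-∼ inv (∼-canonical c))
      ; to∘from   = λ {h} _ → All.tabulate (λ {i} _ → cong h (class-representative i))
      }

involution-free : ∀ {E : Set} (g : E → E) c → g c ≢ c → ∀ {i} → 0 < i → i < 2 → (g ^ i) c ≢ c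
involution-free g c moved {suc zero}    _ _              = moved
involution-free g c moved {suc (suc _)} _ (s≤s (s≤s ()))

-- The symmetries of the square as signed permutations

swapIf : {A : Set} → Bool → A × A → A × A
swapIf false p       = p
swapIf true  (x , y) = y , x

infixl 6 _⊕_

_⊕_ : Bool × Bool → Bool × Bool → Bool × Bool
(a , b) ⊕ (a' , b') = a xor a' , b xor b'

-- (s , a , b) swaps the two coordinates if s, then reflects the first if a and the second if b.
SignedPerm : Set
SignedPerm = Bool × Bool × Bool

infixl 7 _∙_
infix 8 _⁻¹

-- Composition in diagrammatic order, ⟦ g ∙ h ⟧ = ⟦ h ⟧ ∘ ⟦ g ⟧, so that b ↦ b ∘ ⟦ g ⟧ is a left action.
_∙_ : SignedPerm → SignedPerm → SignedPerm
(s , v) ∙ (s' , v') = s xor s' , v' ⊕ swapIf s' v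

ε : SignedPerm
ε = false , false , false

_⁻¹ : SignedPerm → SignedPerm
(s , v) ⁻¹ = s , swapIf s v

private
  swapIf-⊕ : ∀ s u v → swapIf s (u ⊕ v) ≡ swapIf s u ⊕ swapIf s v
  swapIf-⊕ false u       v       = refl
  swapIf-⊕ true  (a , b) (c , d) = refl

  swapIf-xor : ∀ s t {A : Set} (p : A × A) → swapIf t (swapIf s p) ≡ swapIf (s xor t) p
  swapIf-xor false false p       = refl
  swapIf-xor false true  p       = refl
  swapIf-xor true  false p       = refl
  swapIf-xor true  true  (x , y) = refl

  ⊕-assoc : ∀ u v w → (u ⊕ v) ⊕ w ≡ u ⊕ (v ⊕ w)
  ⊕-assoc (a , b) (c , d) (e , f) = cong₂ _,_ (xor-assoc a c e) (xor-assoc b d f)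

  ⊕-identityʳ : ∀ u → u ⊕ (false , false) ≡ u
  ⊕-identityʳ (a , b) = cong₂ _,_ (xor-identityʳ a) (xor-identityʳ b)

  ⊕-self : ∀ u → u ⊕ u ≡ (false , false)
  ⊕-self (a , b) = cong₂ _,_ (xor-same a) (xor-same b)

∙-isGroup : IsGroup _≡_ _∙_ ε _⁻¹
∙-isGroup = record
  { isMonoid = record
    { isSemigroup = record
      { isMagma = record { isEquivalence = isEquivalence ; ∙-cong = cong₂ _∙_ }
      ; assoc   = assoc
      }
    ; identity = identityˡ , identityʳ
    }
  ; inverse = inverseˡ , inverseʳ
  ; ⁻¹-cong = cong _⁻¹
  }
  where
  assoc : ∀ g h k → (g ∙ h) ∙ k ≡ g ∙ (h ∙ k)
  assoc (s₁ , v₁) (s₂ , v₂) (s₃ , v₃) = cong₂ _,_ (xor-assoc s₁ s₂ s₃) (begin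
    v₃ ⊕ swapIf s₃ (v₂ ⊕ swapIf s₂ v₁)             ≡⟨ cong (v₃ ⊕_) (swapIf-⊕ s₃ v₂ (swapIf s₂ v₁)) ⟩
    v₃ ⊕ (swapIf s₃ v₂ ⊕ swapIf s₃ (swapIf s₂ v₁)) ≡⟨ ⊕-assoc v₃ _ _ ⟨
    v₃ ⊕ swapIf s₃ v₂ ⊕ swapIf s₃ (swapIf s₂ v₁)   ≡⟨ cong (v₃ ⊕ swapIf s₃ v₂ ⊕_) (swapIf-xor s₂ s₃ v₁) ⟩
    v₃ ⊕ swapIf s₃ v₂ ⊕ swapIf (s₂ xor s₃) v₁      ∎)
    where open ≡-Reasoning
  identityˡ : ∀ g → ε ∙ g ≡ g
  identityˡ (false , v) = cong (false ,_) (⊕-identityʳ v)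
  identityˡ (true  , v) = cong (true ,_) (⊕-identityʳ v)
  identityʳ : ∀ g → g ∙ ε ≡ g
  identityʳ (s , a , b) = cong (_, a , b) (xor-identityʳ s)
  inverseˡ : ∀ g → g ⁻¹ ∙ g ≡ ε
  inverseˡ (s , v) = cong₂ _,_ (xor-same s) (trans (cong (v ⊕_) (swapIf-xor s s v)) (begin
    v ⊕ swapIf (s xor s) v ≡⟨ cong (λ t → v ⊕ swapIf t v) (xor-same s) ⟩
    v ⊕ v                  ≡⟨ ⊕-self v ⟩
    false , false          ∎))
    where open ≡-Reasoning
  inverseʳ : ∀ g → g ∙ g ⁻¹ ≡ ε
  inverseʳ (s , v) = cong₂ _,_ (xor-same s) (⊕-self (swapIf s v))

flipIf : ∀ {n} → Bool → Fin n → Fin n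
flipIf false i = i
flipIf true  i = opposite i

flips : ∀ {n} → Bool × Bool → Cell n → Cell n
flips (a , b) (i , j) = flipIf a i , flipIf b j

⟦_⟧ : ∀ {n} → SignedPerm → Cell n → Cell n
⟦ s , v ⟧ c = flips v (swapIf s c)

module _ {n : ℕ} where

  flipIf-xor : ∀ a b (i : Fin n) → flipIf a (flipIf b i) ≡ flipIf (a xor b) i
  flipIf-xor false b     i = refl
  flipIf-xor true  false i = refl
  flipIf-xor true  true  i = opposite-involutive i

  private
    flips-⊕ : ∀ u v (c : Cell n) → flips u (flips v c) ≡ flips (u ⊕ v) c
    flips-⊕ (a , b) (a' , b') (i , j) = cong₂ _,_ (flipIf-xor a a' i) (flipIf-xor b b' j)

    swapIf-flips : ∀ s v (c : Cell n) → swapIf s (flips v c) ≡ flips (swapIf s v) (swapIf s c)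
    swapIf-flips false v       c       = refl
    swapIf-flips true  (a , b) (i , j) = refl

  ⟦⟧-∙ : ∀ g h (c : Cell n) → ⟦ g ∙ h ⟧ c ≡ ⟦ h ⟧ (⟦ g ⟧ c)
  ⟦⟧-∙ (s₁ , v₁) (s₂ , v₂) c = sym (begin
    flips v₂ (swapIf s₂ (flips v₁ (swapIf s₁ c)))              ≡⟨ cong (flips v₂) (swapIf-flips s₂ v₁ _) ⟩
    flips v₂ (flips (swapIf s₂ v₁) (swapIf s₂ (swapIf s₁ c)))  ≡⟨ flips-⊕ v₂ (swapIf s₂ v₁) _ ⟩
    flips (v₂ ⊕ swapIf s₂ v₁) (swapIf s₂ (swapIf s₁ c))        ≡⟨ cong (flips (v₂ ⊕ swapIf s₂ v₁)) (swapIf-xor s₁ s₂ c) ⟩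
    flips (v₂ ⊕ swapIf s₂ v₁) (swapIf (s₁ xor s₂) c)           ∎)
    where open ≡-Reasoning

  ⟦ε⟧ : ∀ (c : Cell n) → ⟦ ε ⟧ c ≡ c
  ⟦ε⟧ (i , j) = refl

  ⟦⁻¹⟧-cancel : ∀ g (c : Cell n) → ⟦ g ⁻¹ ⟧ (⟦ g ⟧ c) ≡ c
  ⟦⁻¹⟧-cancel g c =
    trans (sym (⟦⟧-∙ g (g ⁻¹) c)) (trans (cong (λ h → ⟦ h ⟧ c) (IsGroup.inverseʳ ∙-isGroup g)) (⟦ε⟧ c))

  ⟦⟧-cancel : ∀ g (c : Cell n) → ⟦ g ⟧ (⟦ g ⁻¹ ⟧ c) ≡ c
  ⟦⟧-cancel g c =
    trans (sym (⟦⟧-∙ (g ⁻¹) g c)) (trans (cong (λ h → ⟦ h ⟧ c) (IsGroup.inverseˡ ∙-isGroup g)) (⟦ε⟧ c))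

module OddSide (k : ℕ) where

  n : ℕ
  n = 2 * k + 1

  k<n : k < n
  k<n = ≤-<-trans (m≤m+n k (k + 0)) (m<m+n (2 * k) z<s)

  centre : Fin n
  centre = fromℕ< k<n

  private
    opposite+suc : ∀ (i : Fin n) → toℕ (opposite i) + suc (toℕ i) ≡ n
    opposite+suc i = trans (cong (_+ suc (toℕ i)) (opposite-prop i)) (m∸n+n≡m (toℕ<n i))

    twice+1 : ∀ m → m + suc m ≡ 2 * m + 1
    twice+1 = solve-∀

  opposite-fixed⇔centre : ∀ {i : Fin n} → opposite i ≡ i ⇔ i ≡ centre
  opposite-fixed⇔centre {i} = mk⇔
    (λ opp≡ → toℕ-injective (trans (toℕ≡k opp≡) (sym (toℕ-fromℕ< k<n))))
    (λ i≡centre → subst (λ j → opposite j ≡ j) (sym i≡centre) centre-fixed)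
    where
    centre-fixed : opposite centre ≡ centre
    centre-fixed = toℕ-injective (+-cancelʳ-≡ (suc (toℕ centre)) _ _ (begin
      toℕ (opposite centre) + suc (toℕ centre)  ≡⟨ opposite+suc centre ⟩
      2 * k + 1                                  ≡⟨ cong (λ m → 2 * m + 1) (toℕ-fromℕ< k<n) ⟨
      2 * toℕ centre + 1                         ≡⟨ twice+1 (toℕ centre) ⟨
      toℕ centre + suc (toℕ centre)              ∎))
      where open ≡-Reasoning
    toℕ≡k : opposite i ≡ i → toℕ i ≡ k
    toℕ≡k opp≡ = *-cancelˡ-≡ (toℕ i) k 2 (+-cancelʳ-≡ 1 _ _ (begin
      2 * toℕ i + 1                   ≡⟨ twice+1 (toℕ i) ⟨
      toℕ i + suc (toℕ i)             ≡⟨ cong (λ j → toℕ j + suc (toℕ i)) opp≡ ⟨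
      toℕ (opposite i) + suc (toℕ i)  ≡⟨ opposite+suc i ⟩
      2 * k + 1                       ∎))
      where open ≡-Reasoning

  fixedPointsOf : Bool → ℕ
  fixedPointsOf false = n
  fixedPointsOf true  = 1

  flipIf-fixed-count : ∀ a → ∑[ i ∈ allFin n ] 𝟙 (flipIf a i Fin.≟ i) ≡ fixedPointsOf a
  flipIf-fixed-count false =
    trans (∑-cong (allFin n) (λ i → 𝟙-yes (i Fin.≟ i) refl)) (trans (∑-allFin-const n 1) (*-identityʳ n))
  flipIf-fixed-count true  =
    trans (∑-cong (allFin n) (λ i → 𝟙-⇔ (opposite i Fin.≟ i) (i Fin.≟ centre) opposite-fixed⇔centre))
          (Finite.∑-δ (finite-Fin n) centre)

  cellsFinite : Finite (Cell n)
  cellsFinite = finite-× (finite-Fin n) (finite-Fin n)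

  open Finite cellsFinite public using () renaming (elems to cells; _≟_ to _≟ᶜ_)

  cells-length : length cells ≡ n * n
  cells-length = begin
    length cells                            ≡⟨ *-identityʳ _ ⟨
    length cells * 1                        ≡⟨ ∑-const cells 1 ⟨
    ∑[ c ∈ cells ] 1                        ≡⟨ ∑-cartesianProduct (allFin n) (allFin n) (λ _ → 1) ⟩
    ∑[ i ∈ allFin n ] ∑[ j ∈ allFin n ] 1   ≡⟨ ∑-cong (allFin n) (λ _ → trans (∑-allFin-const n 1) (*-identityʳ n)) ⟩
    ∑[ i ∈ allFin n ] n                     ≡⟨ ∑-allFin-const n n ⟩
    n * n                                   ∎
    where open ≡-Reasoning

  fixedCells : SignedPerm → ℕ
  fixedCells (false , a , b) = fixedPointsOf a * fixedPointsOf b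
  fixedCells (true  , a , b) = fixedPointsOf (b xor a)

  private
    ,-≡⇔ : ∀ {i j i' j' : Fin n} → (i , j) ≡ (i' , j') ⇔ (i ≡ i' × j ≡ j')
    ,-≡⇔ = mk⇔ (λ { refl → refl , refl }) (λ { (refl , refl) → refl })

  fixedCells-count : ∀ t → ∑[ c ∈ cells ] 𝟙 (⟦ t ⟧ c ≟ᶜ c) ≡ fixedCells t
  fixedCells-count (false , a , b) = begin
    ∑[ c ∈ cells ] 𝟙 (⟦ false , a , b ⟧ c ≟ᶜ c)
      ≡⟨ ∑-cartesianProduct (allFin n) (allFin n) _ ⟩
    ∑[ i ∈ allFin n ] ∑[ j ∈ allFin n ] 𝟙 ((flipIf a i , flipIf b j) ≟ᶜ (i , j))
      ≡⟨ ∑-cong (allFin n) (λ i → ∑-cong (allFin n) (λ j →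
           trans (𝟙-⇔ ((flipIf a i , flipIf b j) ≟ᶜ (i , j)) (flipIf a i Fin.≟ i ×-dec flipIf b j Fin.≟ j) ,-≡⇔)
                 (𝟙-× (flipIf a i Fin.≟ i) (flipIf b j Fin.≟ j)))) ⟩
    ∑[ i ∈ allFin n ] ∑[ j ∈ allFin n ] 𝟙 (flipIf a i Fin.≟ i) * 𝟙 (flipIf b j Fin.≟ j)
      ≡⟨ ∑-cong (allFin n) (λ i → ∑-*ˡ (allFin n) (𝟙 (flipIf a i Fin.≟ i)) (λ j → 𝟙 (flipIf b j Fin.≟ j))) ⟩
    ∑[ i ∈ allFin n ] 𝟙 (flipIf a i Fin.≟ i) * (∑[ j ∈ allFin n ] 𝟙 (flipIf b j Fin.≟ j))
      ≡⟨ ∑-*ʳ (allFin n) _ _ ⟩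
    (∑[ i ∈ allFin n ] 𝟙 (flipIf a i Fin.≟ i)) * (∑[ j ∈ allFin n ] 𝟙 (flipIf b j Fin.≟ j))
      ≡⟨ cong₂ _*_ (flipIf-fixed-count a) (flipIf-fixed-count b) ⟩
    fixedPointsOf a * fixedPointsOf b ∎
    where open ≡-Reasoning
  fixedCells-count (true , a , b) = begin
    ∑[ c ∈ cells ] 𝟙 (⟦ true , a , b ⟧ c ≟ᶜ c)
      ≡⟨ ∑-cartesianProduct (allFin n) (allFin n) _ ⟩
    ∑[ i ∈ allFin n ] ∑[ j ∈ allFin n ] 𝟙 ((flipIf a j , flipIf b i) ≟ᶜ (i , j))
      ≡⟨ ∑-cong (allFin n) (λ i → ∑-cong (allFin n) (λ j →
           trans (𝟙-⇔ ((flipIf a j , flipIf b i) ≟ᶜ (i , j)) (i Fin.≟ flipIf a j ×-dec K? j) diagonal)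
                 (𝟙-× (i Fin.≟ flipIf a j) (K? j)))) ⟩
    ∑[ i ∈ allFin n ] ∑[ j ∈ allFin n ] 𝟙 (i Fin.≟ flipIf a j) * 𝟙 (K? j)
      ≡⟨ ∑-swap (allFin n) (allFin n) _ ⟩
    ∑[ j ∈ allFin n ] ∑[ i ∈ allFin n ] 𝟙 (i Fin.≟ flipIf a j) * 𝟙 (K? j)
      ≡⟨ ∑-cong (allFin n) (λ j → Finite.∑-select (finite-Fin n) (flipIf a j) (λ _ → 𝟙 (K? j))) ⟩
    ∑[ j ∈ allFin n ] 𝟙 (K? j)
      ≡⟨ flipIf-fixed-count (b xor a) ⟩
    fixedPointsOf (b xor a) ∎
    where
    open ≡-Reasoning
    K? : ∀ j → Dec (flipIf (b xor a) j ≡ j)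
    K? j = flipIf (b xor a) j Fin.≟ j
    diagonal : ∀ {i j} → (flipIf a j , flipIf b i) ≡ (i , j) ⇔ (i ≡ flipIf a j × flipIf (b xor a) j ≡ j)
    diagonal {i} {j} = mk⇔
      (λ eq → sym (cong proj₁ eq)
            , trans (sym (flipIf-xor b a j)) (trans (cong (flipIf b) (cong proj₁ eq)) (cong proj₂ eq)))
      (λ { (refl , q) → cong (flipIf a j ,_) (trans (flipIf-xor b a j) q) })

  flipIf-centre : ∀ a → flipIf a centre ≡ centre
  flipIf-centre false = refl
  flipIf-centre true  = Equivalence.from opposite-fixed⇔centre refl

  centre-fixed : ∀ t → ⟦ t ⟧ (centre , centre) ≡ (centre , centre)
  centre-fixed (false , a , b) = cong₂ _,_ (flipIf-centre a) (flipIf-centre b)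
  centre-fixed (true  , a , b) = cong₂ _,_ (flipIf-centre a) (flipIf-centre b)

  half-turn-fixed : ∀ {c} → ⟦ false , true , true ⟧ c ≡ c → c ≡ (centre , centre)
  half-turn-fixed eq = cong₂ _,_ (Equivalence.to opposite-fixed⇔centre (cong proj₁ eq))
                                 (Equivalence.to opposite-fixed⇔centre (cong proj₂ eq))

toSigned : D4 → SignedPerm
toSigned id    = false , false , false
toSigned r90   = true  , false , true
toSigned r180  = false , true  , true
toSigned r270  = true  , true  , false
toSigned flipH = false , true  , false
toSigned flipV = false , false , true
toSigned flipD = true  , false , false
toSigned flipA = true  , true  , true

act-toSigned : ∀ {n} g (c : Cell n) → act g c ≡ ⟦ toSigned g ⟧ c
act-toSigned id    (i , j) = refl
act-toSigned r90   (i , j) = refl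
act-toSigned r180  (i , j) = refl
act-toSigned r270  (i , j) = refl
act-toSigned flipH (i , j) = refl
act-toSigned flipV (i , j) = refl
act-toSigned flipD (i , j) = refl
act-toSigned flipA (i , j) = refl

toSigned-surjective : ∀ t → ∃[ g ] toSigned g ≡ t
toSigned-surjective (false , false , false) = id    , refl
toSigned-surjective (true  , false , true)  = r90   , refl
toSigned-surjective (false , true  , true)  = r180  , refl
toSigned-surjective (true  , true  , false) = r270  , refl
toSigned-surjective (false , true  , false) = flipH , refl
toSigned-surjective (false , false , true)  = flipV , refl
toSigned-surjective (true  , false , false) = flipD , refl
toSigned-surjective (true  , true  , true)  = flipA , refl

finite-SignedPerm : Finite SignedPerm
finite-SignedPerm = finite-× finite-Bool (finite-× finite-Bool finite-Bool)

module Boards (k r : ℕ) where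
  open OddSide k

  boards : Enumeration
  boards = functionSpace _≟ᶜ_ cells (Finite.unique cellsFinite)

  blockedCount-cells : ∀ (b : Board n) → blockedCount b ≡ ∑[ c ∈ cells ] bit (b c)
  blockedCount-cells b = sym (∑-cartesianProduct (allFin n) (allFin n) (bit ∘ b))

  blockedCount-⟦⟧ : ∀ t (b : Board n) → blockedCount (b ∘ ⟦ t ⟧) ≡ blockedCount b
  blockedCount-⟦⟧ t b = begin
    blockedCount (b ∘ ⟦ t ⟧)
      ≡⟨ blockedCount-cells (b ∘ ⟦ t ⟧) ⟩
    ∑[ c ∈ cells ] bit (b (⟦ t ⟧ c))
      ≡⟨ Finite.∑-reindex cellsFinite ⟦ t ⟧ ⟦ t ⁻¹ ⟧ (⟦⁻¹⟧-cancel t) (⟦⟧-cancel t) (bit ∘ b) ⟩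
    ∑[ c ∈ cells ] bit (b c)
      ≡⟨ blockedCount-cells b ⟨
    blockedCount b ∎
    where open ≡-Reasoning

  blockedCount-cong : ∀ {b b'} → Agree _≟ᶜ_ cells b b' → blockedCount b ≡ blockedCount b'
  blockedCount-cong {b} {b'} b≐b' = begin
    blockedCount b             ≡⟨ blockedCount-cells b ⟩
    ∑[ c ∈ cells ] bit (b c)   ≡⟨ ∑-cong-∈ cells (λ c∈ → cong bit (All.lookup b≐b' c∈)) ⟩
    ∑[ c ∈ cells ] bit (b' c)  ≡⟨ blockedCount-cells b' ⟨
    blockedCount b'            ∎
    where open ≡-Reasoning

  boardsWith : Enumeration
  boardsWith = restrict boards (λ b → blockedCount b ≟ℕ r)
                        (λ b≐b' count≡r → trans (sym (blockedCount-cong b≐b')) count≡r)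

  _⋆_ : SignedPerm → BoardR n r → BoardR n r
  t ⋆ (b , count≡r) = b ∘ ⟦ t ⟧ , trans (blockedCount-⟦⟧ t b) count≡r

  boardAction : Action _∙_ ε boardsWith
  boardAction = record
    { _⋆_    = _⋆_
    ; ⋆-cong = λ t b≐b' → All.tabulate (λ {c} _ → All.lookup b≐b' (Finite.complete cellsFinite (⟦ t ⟧ c)))
    ; ε-⋆    = λ (b , _) → All.tabulate (λ {c} _ → cong b (⟦ε⟧ c))
    ; ∙-⋆    = λ g h (b , _) → All.tabulate (λ {c} _ → cong b (⟦⟧-∙ g h c))
    }

  open Burnside finite-SignedPerm ∙-isGroup boardsWith boardAction public

  fixedBoards : SignedPerm → ℕ
  fixedBoards t = Enumeration.count boardsWith (λ x → Enumeration._≟_ boardsWith (t ⋆ x) x)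

  record OrbitCount (t : SignedPerm) (d : ℕ) : Set where
    field
      moved         : ℕ
      cells-split   : n * n ≡ fixedCells t + moved * d
      fixedBoards-≡ : fixedBoards t ≡ subsetsWithSum (replicate (fixedCells t) 1 ++ replicate moved d) r

  fixedBoards-cyclic : ∀ t d .{{_ : NonZero d}} →
    (∀ c → (⟦ t ⟧ ^ d) c ≡ c) → (∀ c → ⟦ t ⟧ c ≢ c → ∀ {i} → 0 < i → i < d → (⟦ t ⟧ ^ i) c ≢ c) →
    OrbitCount t d
  fixedBoards-cyclic t d period free = record
    { moved         = movedOrbits
    ; cells-split   = trans (sym cells-length) (trans size (cong (_+ movedOrbits * d) (fixedCells-count t)))
    ; fixedBoards-≡ = fixed-count
    }
    where
    open CyclicAction cellsFinite ⟦ t ⟧ d period free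
    fixed-count : fixedBoards t ≡ subsetsWithSum (replicate (fixedCells t) 1 ++ replicate movedOrbits d) r
    fixed-count = begin
      fixedBoards t
        ≡⟨ ∑-withProofs boards (λ b → blockedCount b ≟ℕ r) (Enumeration.elems boards) _ ⟩
      ∑[ b ∈ Enumeration.elems boards ] 𝟙 (blockedCount b ≟ℕ r) * 𝟙 (invariant? b)
        ≡⟨ ∑-cong (Enumeration.elems boards) reorder ⟩
      Enumeration.count colourings (λ b → invariant? b ×-dec ones b ≟ℕ r)
        ≡⟨ invariant-count r ⟩
      subsetsWithSum (replicate fixedPoints 1 ++ replicate movedOrbits d) r
        ≡⟨ cong (λ f → subsetsWithSum (replicate f 1 ++ replicate movedOrbits d) r) (fixedCells-count t) ⟩
      subsetsWithSum (replicate (fixedCells t) 1 ++ replicate movedOrbits d) r ∎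
      where
      open ≡-Reasoning
      reorder : ∀ b → 𝟙 (blockedCount b ≟ℕ r) * 𝟙 (invariant? b) ≡ 𝟙 (invariant? b ×-dec ones b ≟ℕ r)
      reorder b = begin
        𝟙 (blockedCount b ≟ℕ r) * 𝟙 (invariant? b)  ≡⟨ cong (λ m → 𝟙 (m ≟ℕ r) * 𝟙 (invariant? b)) (blockedCount-cells b) ⟩
        𝟙 (ones b ≟ℕ r) * 𝟙 (invariant? b)          ≡⟨ *-comm (𝟙 (ones b ≟ℕ r)) (𝟙 (invariant? b)) ⟩
        𝟙 (invariant? b) * 𝟙 (ones b ≟ℕ r)          ≡⟨ 𝟙-× (invariant? b) (ones b ≟ℕ r) ⟨
        𝟙 (invariant? b ×-dec ones b ≟ℕ r)          ∎

  involution : ∀ t → t ∙ t ≡ ε → OrbitCount t 2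
  involution t t∙t≡ε = fixedBoards-cyclic t 2
    (λ c → trans (sym (⟦⟧-∙ t t c)) (trans (cong (λ s → ⟦ s ⟧ c) t∙t≡ε) (⟦ε⟧ c)))
    (involution-free ⟦ t ⟧)

  half-turn : SignedPerm
  half-turn = false , true , true

  quarter-turn : ∀ a b → (true , a , b) ∙ (true , a , b) ≡ half-turn → OrbitCount (true , a , b) 4
  quarter-turn a b t∙t≡half = fixedBoards-cyclic t 4 period free
    where
    t : SignedPerm
    t = true , a , b
    twice : ∀ c → ⟦ t ⟧ (⟦ t ⟧ c) ≡ ⟦ half-turn ⟧ c
    twice c = trans (sym (⟦⟧-∙ t t c)) (cong (λ s → ⟦ s ⟧ c) t∙t≡half)
    period : ∀ c → (⟦ t ⟧ ^ 4) c ≡ c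
    period c = trans (twice (⟦ t ⟧ (⟦ t ⟧ c)))
                     (trans (cong ⟦ half-turn ⟧ (twice c)) (trans (sym (⟦⟧-∙ half-turn half-turn c)) (⟦ε⟧ c)))
    free : ∀ c → ⟦ t ⟧ c ≢ c → ∀ {i} → 0 < i → i < 4 → (⟦ t ⟧ ^ i) c ≢ c
    free c moved {1} _ _ = moved
    free c moved {2} _ _ back =
      moved (subst (λ x → ⟦ t ⟧ x ≡ x) (sym (half-turn-fixed (trans (sym (twice c)) back))) (centre-fixed t))
    free c moved {3} _ _ back = moved (trans (cong ⟦ t ⟧ (sym back)) (period c))
    free c moved {suc (suc (suc (suc _)))} _ (s≤s (s≤s (s≤s (s≤s ()))))

  ∼⇔Equivalent : ∀ {x y} → x ∼ y ⇔ Equivalent (proj₁ x) (proj₁ y)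
  ∼⇔Equivalent {b , _} {b' , _} = mk⇔
    (λ (t , b'≐b∘t) → let (g , g↦t) = toSigned-surjective t in
      g , λ c → trans (All.lookup b'≐b∘t (Finite.complete cellsFinite c))
                      (cong b (sym (trans (act-toSigned g c) (cong (λ s → ⟦ s ⟧ c) g↦t)))))
    (λ (g , b'≡b∘g) → toSigned g , All.tabulate (λ {c} _ → trans (b'≡b∘g c) (cong b (act-toSigned g c))))

private
  +-*-cancel-≡ : ∀ f m m' d .{{_ : NonZero d}} → f + m * d ≡ f + m' * d → m ≡ m'
  +-*-cancel-≡ f m m' d eq = *-cancelʳ-≡ m m' d (+-cancelˡ-≡ f _ _ eq)

module ClassCount (k r' : ℕ) where
  open OddSide k
  open Boards k (suc r') public

  r : ℕ
  r = suc r'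

  flipSum : ℕ
  flipSum = ∑[ t ∈ upTo (suc r) ] (n C t) * binomFrac (k * n) (r ∸ t) 2

  quarterSum : ℕ
  quarterSum = binomFrac (k * (k + 1)) r 4 + binomFrac (k * (k + 1)) r' 4

  identity-count : fixedBoards ε ≡ (n * n) C r
  identity-count = begin
    fixedBoards ε
      ≡⟨ fixedBoards-≡ ⟩
    subsetsWithSum (replicate (n * n) 1 ++ replicate moved 2) r
      ≡⟨ cong (λ m → S (replicate m 2)) moved≡0 ⟩
    subsetsWithSum (replicate (n * n) 1 ++ []) r
      ≡⟨ cong (λ ws → subsetsWithSum ws r) (++-identityʳ (replicate (n * n) 1)) ⟩
    subsetsWithSum (replicate (n * n) 1) r
      ≡⟨ subsetsWithSum-ones (n * n) r ⟩
    (n * n) C r ∎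
    where
    open ≡-Reasoning
    open OrbitCount (involution ε refl)
    S : List ℕ → ℕ
    S ws = subsetsWithSum (replicate (n * n) 1 ++ ws) r
    moved≡0 : moved ≡ 0
    moved≡0 = +-*-cancel-≡ (n * n) moved 0 2 (trans (sym cells-split) (sym (+-identityʳ (n * n))))

  flip-count : ∀ t → t ∙ t ≡ ε → fixedCells t ≡ n → fixedBoards t ≡ flipSum
  flip-count t t∙t≡ε fixed≡n = begin
    fixedBoards t
      ≡⟨ fixedBoards-≡ ⟩
    subsetsWithSum (replicate (fixedCells t) 1 ++ replicate moved 2) r
      ≡⟨ cong₂ (λ f m → subsetsWithSum (replicate f 1 ++ replicate m 2) r) fixed≡n moved≡kn ⟩
    subsetsWithSum (replicate n 1 ++ replicate (k * n) 2) r
      ≡⟨ subsetsWithSum-ones-++ n (replicate (k * n) 2) r ⟩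
    ∑[ t ∈ upTo (suc r) ] (n C t) * subsetsWithSum (replicate (k * n) 2) (r ∸ t)
      ≡⟨ ∑-cong (upTo (suc r)) (λ t → cong ((n C t) *_) (subsetsWithSum-replicate (k * n) (r ∸ t) 2)) ⟩
    flipSum ∎
    where
    open ≡-Reasoning
    open OrbitCount (involution t t∙t≡ε)
    square : ∀ k → (2 * k + 1) * (2 * k + 1) ≡ (2 * k + 1) + (k * (2 * k + 1)) * 2
    square = solve-∀
    moved≡kn : moved ≡ k * n
    moved≡kn = +-*-cancel-≡ n moved (k * n) 2
      (trans (cong (_+ moved * 2) (sym fixed≡n)) (trans (sym cells-split) (square k)))

  half-turn-count : fixedBoards half-turn ≡ (2 * k * (k + 1)) C (r / 2)
  half-turn-count = begin
    fixedBoards half-turn                        ≡⟨ fixedBoards-≡ ⟩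
    subsetsWithSum (1 ∷ replicate moved 2) r     ≡⟨ cong₂ _+_ (subsetsWithSum-replicate moved r 2)
                                                             (subsetsWithSum-replicate moved r' 2) ⟩
    binomFrac moved r 2 + binomFrac moved r' 2    ≡⟨ binomFrac-consecutive moved r' ⟩
    moved C (r / 2)                              ≡⟨ cong (λ m → m C (r / 2)) moved≡ ⟩
    (2 * k * (k + 1)) C (r / 2)                  ∎
    where
    open ≡-Reasoning
    open OrbitCount (involution half-turn refl)
    square : ∀ k → (2 * k + 1) * (2 * k + 1) ≡ 1 + (2 * k * (k + 1)) * 2
    square = solve-∀
    moved≡ : moved ≡ 2 * k * (k + 1)
    moved≡ = +-*-cancel-≡ 1 moved (2 * k * (k + 1)) 2 (trans (sym cells-split) (square k))

  quarter-turn-count : ∀ a b → (true , a , b) ∙ (true , a , b) ≡ half-turn → fixedCells (true , a , b) ≡ 1 →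
                       fixedBoards (true , a , b) ≡ quarterSum
  quarter-turn-count a b t∙t≡half fixed≡1 = begin
    fixedBoards (true , a , b)
      ≡⟨ fixedBoards-≡ ⟩
    subsetsWithSum (replicate (fixedCells (true , a , b)) 1 ++ replicate moved 4) r
      ≡⟨ cong₂ (λ f m → subsetsWithSum (replicate f 1 ++ replicate m 4) r) fixed≡1 moved≡ ⟩
    subsetsWithSum (1 ∷ replicate (k * (k + 1)) 4) r
      ≡⟨ cong₂ _+_ (subsetsWithSum-replicate (k * (k + 1)) r 4)
                   (subsetsWithSum-replicate (k * (k + 1)) r' 4) ⟩
    quarterSum ∎
    where
    open ≡-Reasoning
    open OrbitCount (quarter-turn a b t∙t≡half)
    square : ∀ k → (2 * k + 1) * (2 * k + 1) ≡ 1 + (k * (k + 1)) * 4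
    square = solve-∀
    moved≡ : moved ≡ k * (k + 1)
    moved≡ = +-*-cancel-≡ 1 moved (k * (k + 1)) 4
      (trans (cong (_+ moved * 4) (sym fixed≡1)) (trans (sym cells-split) (square k)))

  orbit-formula : 8 * classes ≡ formula k r
  orbit-formula = begin
    8 * classes
      ≡⟨ burnside ⟨
    fixedBoards (false , false , false) + (fixedBoards (false , false , true) + (fixedBoards (false , true , false)
      + (fixedBoards (false , true , true) + (fixedBoards (true , false , false) + (fixedBoards (true , false , true)
      + (fixedBoards (true , true , false) + (fixedBoards (true , true , true) + 0)))))))
      ≡⟨ cong₂ _+_ identity-count
        (cong₂ _+_ (flip-count (false , false , true) refl (*-identityʳ n))
        (cong₂ _+_ (flip-count (false , true , false) refl (+-identityʳ n))
        (cong₂ _+_ half-turn-count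
        (cong₂ _+_ (flip-count (true , false , false) refl refl)
        (cong₂ _+_ (quarter-turn-count false true refl refl)
        (cong₂ _+_ (quarter-turn-count true false refl refl)
        (cong (_+ 0) (flip-count (true , true , true) refl refl)))))))) ⟩
    (n * n) C r + (flipSum + (flipSum + (halfSum + (flipSum + (quarterSum + (quarterSum + (flipSum + 0)))))))
      ≡⟨ collect ((n * n) C r) flipSum halfSum (binomFrac (k * (k + 1)) r 4) (binomFrac (k * (k + 1)) r' 4) ⟩
    formula k r ∎
    where
    open ≡-Reasoning
    halfSum : ℕ
    halfSum = (2 * k * (k + 1)) C (r / 2)
    collect : ∀ c s h a b → c + (s + (s + (h + (s + ((a + b) + ((a + b) + (s + 0)))))))
                          ≡ c + 2 * a + 2 * b + h + 4 * s
    collect = solve-∀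

proposition5p2 : (k r : ℕ) → 1 ≤ k → 1 ≤ r → r ≤ (2 * k + 1) * (2 * k + 1) →
    Σ ℕ (λ N → (8 * N ≡ formula k r) × HasNClasses {2 * k + 1} r N)
proposition5p2 k zero    _ () _
proposition5p2 k (suc r) _ _  _ =
  classes , orbit-formula , class , (λ i → representative i , class-representative i) , λ x y →
    mk⇔ (Equivalence.to (∼⇔Equivalent {x} {y}) ∘ Equivalence.to (class-≡⇔∼ {x} {y}))
        (Equivalence.from (class-≡⇔∼ {x} {y}) ∘ Equivalence.from (∼⇔Equivalent {x} {y}))
  where open ClassCount k r
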